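{- A conserved interval $J$ of $\mathcal{P}$ is $b$-nested if and only if either $J$ contains no $b$-gap, or $J$ contains exactly one $b$-gap and this $b$-gap is good.
   Context: Let $n\ge 2$, $K\ge1$, and let $\mathcal{P}=\{P_1,\ldots,P_K\}$ be a set of signed permutations of $\{1,\ldots,n\}$: each $P_k$ is a sequence in which each of $1,\ldots,n$ appears exactly once, with a sign $+$ or $-$. Assume each $P_k$ begins with $+1$ and ends with $+n$, and $P_1=\mathrm{Id}_n$ (identity order, all signs $+$). For $i\le j$, $(i..j)=\{i,\ldots,j\}$. A conserved interval of $\mathcal{P}$ is either a singleton, or a set $(a..c)$ with $a<c$ such that in every $P_k$ the elements of $(a..c)$ (ignoring signs) occupy consecutive positions and this block is delimited either by $+a$ on the left and $+c$ on the right, or by $-c$ on the left and $-a$ on the right. Intervals $(i..j)$ and $(k..l)$ overlap if $i<k\le j<l$ or $k<i\le l<j$. A conserved interval is strong if it has at least two elements and overlaps no conserved interval. For a conserved interval $I=(a..c)$, a set $\{f_1,\ldots,f_k\}$ with $a=f_1<\cdots<f_k=c$ is a set of frontiers of $I$ if $(f_i..f_j)$ is conserved for all $1\le i<j\le k$; every conserved interval $I$ has a unique inclusion-maximal set of frontiers, denoted $F_I$. Fix a positive integer $b$. A conserved interval $I$ is $b$-nested if $|I|=1$ or $I$ strictly contains a $b$-nested conserved interval $I'$ with $|I'|\ge|I|-b$. Let $F_J=\{f_1<\cdots<f_k\}$. $J$ contains a $b$-gap at position $l$ if $|(f_l..f_{l+1})|=f_{l+1}-f_l+1>b+1$. A $b$-gap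 at position $l$ is good if there is a $b$-nested strong conserved interval $I=(a..c)$ with $f_l<a\le c<f_{l+1}$ and $|I|\ge f_{l+1}-f_l+1-b$. -}

module Defs where

open import Data.Nat using (ℕ; zero; suc; _+_; _∸_; _≤_; _<_)
open import Data.Integer using (ℤ; +_; -_; ∣_∣)
open import Data.List using (List; []; _∷_; _++_; map; upTo; head; last)
open import Data.List.Relation.Unary.All using (All)
open import Data.List.Relation.Unary.AllPairs using (AllPairs)
open import Data.List.Relation.Binary.Permutation.Propositional using (_↭_)
open import Data.List.Relation.Binary.Subset.Propositional using (_⊆_)
open import Data.Maybe using (just)
open import Data.Product using (_×_; _,_; ∃; ∃-syntax)
open import Data.Sum using (_⊎_)
open import Relation.Binary.PropositionalEquality using (_≡_)
open import Relation.Nullary using (¬_)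

iv : ℕ → ℕ → List ℕ
iv a c = map (λ i → a + i) (upTo (suc (c ∸ a)))

size : ℕ → ℕ → ℕ
size i j = suc (j ∸ i)

-- Signed permutations are lists of integers: +k is (+ k), -k is (- (+ k)).
IsSignedPerm : ℕ → List ℤ → Set
IsSignedPerm n P = map ∣_∣ P ↭ iv 1 n

StartsEnds : ℕ → List ℤ → Set
StartsEnds n P = head P ≡ just (+ 1) × last P ≡ just (+ n)

idPerm : ℕ → List ℤ
idPerm n = map +_ (iv 1 n)

Family : Set
Family = List (List ℤ)

BlockIn : ℕ → ℕ → List ℤ → Set
BlockIn a c P =
  ∃[ L ] ∃[ B ] ∃[ R ]
    (P ≡ L ++ B ++ R) × (map ∣_∣ B ↭ iv a c) ×
    ((head B ≡ just (+ a) × last B ≡ just (+ c)) ⊎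
     (head B ≡ just (- (+ c)) × last B ≡ just (- (+ a))))

Conserved : ℕ → Family → ℕ → ℕ → Set
Conserved n Ps a c =
  (a ≡ c × 1 ≤ a × a ≤ n) ⊎ (a < c × All (BlockIn a c) Ps)

Overlap : ℕ → ℕ → ℕ → ℕ → Set
Overlap i j k l = (i < k × k ≤ j × j < l) ⊎ (k < i × i ≤ l × l < j)

Strong : ℕ → Family → ℕ → ℕ → Set
Strong n Ps a c =
  Conserved n Ps a c × 2 ≤ size a c ×
  (∀ k l → Conserved n Ps k l → ¬ Overlap a c k l)

IsFrontiers : ℕ → Family → ℕ → ℕ → List ℕ → Set
IsFrontiers n Ps a c F =
  AllPairs _<_ F × head F ≡ just a × last F ≡ just c ×
  AllPairs (Conserved n Ps) F

IsMaxFrontiers : ℕ → Family → ℕ → ℕ → List ℕ → Set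
IsMaxFrontiers n Ps a c F =
  IsFrontiers n Ps a c F ×
  (∀ G → IsFrontiers n Ps a c G → F ⊆ G → G ⊆ F)

data Nested (n : ℕ) (Ps : Family) (b : ℕ) : ℕ → ℕ → Set where
  single : ∀ a → Nested n Ps b a a
  step : ∀ {a c a' c'} →
         Conserved n Ps a' c' →
         a ≤ a' → c' ≤ c → (a < a' ⊎ c' < c) →
         Nested n Ps b a' c' →
         size a c ≤ size a' c' + b →
         Nested n Ps b a c

pairs : List ℕ → List (ℕ × ℕ)
pairs (x ∷ y ∷ xs) = (x , y) ∷ pairs (y ∷ xs)
pairs _ = []

Gap : ℕ → ℕ × ℕ → Set
Gap b (x , y) = suc b < size x y

GoodGap : ℕ → Family → ℕ → ℕ × ℕ → Set
GoodGap n Ps b (x , y) =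
  ∃[ a ] ∃[ c ]
    Strong n Ps a c × Nested n Ps b a c ×
    x < a × a ≤ c × c < y × size x y ≤ size a c + b

NoGap : ℕ → List ℕ → Set
NoGap b F = All (λ p → ¬ Gap b p) (pairs F)

ExactlyOneGoodGap : ℕ → Family → ℕ → List ℕ → Set
ExactlyOneGoodGap n Ps b F =
  ∃[ L ] ∃[ p ] ∃[ R ]
    (pairs F ≡ L ++ p ∷ R) ×
    All (λ q → ¬ Gap b q) L × All (λ q → ¬ Gap b q) R ×
    Gap b p × GoodGap n Ps b p

-- Conserved intervals are closed under the union of two overlapping or abutting intervals and
-- under the difference of two nested intervals sharing an endpoint; the rest is combinatorics of
-- frontiers. Let (a..c) be b-nested through a conserved (a'..c') with at most b fewer elements.
-- If a' and c' are frontiers of (a..c), the consecutive frontiers of (a..c) are those of (a'..c')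
-- plus pairs inside the two margins, which together have at most b elements. Otherwise (a'..c')
-- lies strictly between two consecutive frontiers x < y, all other consecutive pairs lie in the
-- margins, and repeatedly merging (a'..c') with an overlapping conserved interval, which never
-- leaves (x..y), ends in a strong b-nested interval showing that (x..y) is a good gap.
-- Conversely, starting from {a} or from a good gap, one reaches (a..c) by adding the pairs of
-- consecutive frontiers one at a time, each contributing at most b new elements.

module Submission where

open import Defs
open import Data.Nat using (ℕ; _≤_)
open import Data.Integer using (ℤ)
open import Data.List using (List; _∷_)
open import Data.List.Relation.Unary.All using (All)
open import Data.Product using (_×_)
open import Data.Sum using (_⊎_)
open import Function.Bundles using (_⇔_)

open import Data.Empty using (⊥; ⊥-elim)
open import Data.Nat using (zero; suc; _+_; _∸_; _<_; z≤n; s≤s; s≤s⁻¹; _≟_; _≤?_; _<?_)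
open import Data.Nat.Properties
open import Data.Integer using (+_; -_; ∣_∣)
open import Data.Integer.Properties using (∣-i∣≡∣i∣) renaming (_≟_ to _≟ℤ_)
open import Data.List using ([]; _++_; map; head; last; filter)
open import Data.List.Properties using (∷-injective; ++-assoc; ++-identityʳ; filter-accept; filter-++)
open import Data.List.Relation.Unary.All using ([]; _∷_)
import Data.List.Relation.Unary.All as All
open import Data.List.Relation.Unary.Any using (Any; here; there)
import Data.List.Relation.Unary.Any as Any
import Data.List.Relation.Unary.Any.Properties as Any
open import Data.List.Relation.Unary.AllPairs using (AllPairs; []; _∷_)
import Data.List.Relation.Unary.AllPairs.Properties as AllPairs
open import Data.List.Relation.Unary.Unique.Propositional using (Unique)
import Data.List.Relation.Unary.Unique.Propositional.Properties as Unique
open import Data.List.Membership.Propositional using (_∈_)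
open import Data.List.Membership.Propositional.Properties
  using (∈-map⁺; ∈-map⁻; ∈-upTo⁺; ∈-upTo⁻; ∈-filter⁺; ∈-filter⁻; ∈-++⁺ˡ; ∈-++⁺ʳ; ∈-∃++)
open import Data.List.Membership.Propositional.Properties.WithK using (unique∧set⇒bag)
open import Data.List.Relation.Binary.BagAndSetEquality using (∼bag⇒↭)
open import Data.List.Relation.Binary.Permutation.Propositional using (_↭_; ↭-sym; ↭-reflexive; ↭⇒↭ₛ)
open import Data.List.Relation.Binary.Permutation.Propositional.Properties using (∈-resp-↭)
import Data.List.Relation.Binary.Permutation.Setoid.Properties as ↭ₛ
open import Data.Maybe using (Maybe; just)
import Data.Maybe.Properties as Maybe
open import Data.Product using (Σ; ∃; _,_; proj₁; proj₂)
open import Data.Sum using (inj₁; inj₂; [_,_]′)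
open import Function.Base using (id; case_of_)
open import Function.Bundles using (mk⇔)
open import Level using (0ℓ)
open import Relation.Binary.Core using (Rel)
open import Relation.Binary.Definitions using (tri<; tri≈; tri>)
open import Relation.Binary.PropositionalEquality
open import Relation.Nullary using (¬_; Dec; yes; no)
open import Relation.Nullary.Decidable using (_×-dec_; _⊎-dec_)

∸-split : ∀ {a m c} → a ≤ m → m ≤ c → c ∸ a ≡ (c ∸ m) + (m ∸ a)
∸-split {a} {m} {c} a≤m m≤c = begin
  c ∸ a              ≡⟨ cong (_∸ a) (sym (m∸n+n≡m m≤c)) ⟩
  (c ∸ m) + m ∸ a    ≡⟨ +-∸-assoc (c ∸ m) a≤m ⟩
  (c ∸ m) + (m ∸ a)  ∎
  where open ≡-Reasoning

margins≤ : ∀ {a a' c' c b} → a ≤ a' → a' ≤ c' → c' ≤ c →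
           c ∸ a ≤ (c' ∸ a') + b → (a' ∸ a) + (c ∸ c') ≤ b
margins≤ {a} {a'} {c'} {c} a≤a' a'≤c' c'≤c le =
  +-cancelˡ-≤ (c' ∸ a') _ _ (≤-trans (≤-reflexive widths) le)
  where
  open ≡-Reasoning
  widths : (c' ∸ a') + ((a' ∸ a) + (c ∸ c')) ≡ c ∸ a
  widths = begin
    (c' ∸ a') + ((a' ∸ a) + (c ∸ c'))  ≡⟨ sym (+-assoc (c' ∸ a') _ _) ⟩
    (c' ∸ a') + (a' ∸ a) + (c ∸ c')    ≡⟨ cong (_+ (c ∸ c')) (sym (∸-split a≤a' a'≤c')) ⟩
    (c' ∸ a) + (c ∸ c')                ≡⟨ +-comm (c' ∸ a) _ ⟩
    (c ∸ c') + (c' ∸ a)                ≡⟨ sym (∸-split (≤-trans a≤a' a'≤c') c'≤c) ⟩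
    c ∸ a                              ∎

marginˡ≤ : ∀ {a a' c' c b} → a ≤ a' → a' ≤ c' → c' ≤ c →
           c ∸ a ≤ (c' ∸ a') + b → a' ∸ a ≤ b
marginˡ≤ p q r le = ≤-trans (m≤m+n _ _) (margins≤ p q r le)

marginʳ≤ : ∀ {a a' c' c b} → a ≤ a' → a' ≤ c' → c' ≤ c →
           c ∸ a ≤ (c' ∸ a') + b → c ∸ c' ≤ b
marginʳ≤ p q r le = ≤-trans (m≤n+m _ _) (margins≤ p q r le)

module _ {P : ℕ → Set} (P? : ∀ z → Dec (P z)) where

  greatest-≤ : ∀ lo hi → lo ≤ hi → P lo →
    Σ ℕ λ z → lo ≤ z × z ≤ hi × P z × (∀ w → z < w → w ≤ hi → ¬ P w)
  greatest-≤ lo zero lo≤0 Plo with P? zero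
  ... | yes P0 = zero , lo≤0 , ≤-refl , P0 , λ w z<w w≤0 _ → <⇒≱ z<w w≤0
  ... | no ¬P0 = ⊥-elim (¬P0 (subst P (n≤0⇒n≡0 lo≤0) Plo))
  greatest-≤ lo (suc h) lo≤ Plo with P? (suc h)
  ... | yes Ph = suc h , lo≤ , ≤-refl , Ph , λ w z<w w≤ _ → <⇒≱ z<w w≤
  ... | no ¬Ph with m≤n⇒m<n∨m≡n lo≤
  ...   | inj₂ refl = ⊥-elim (¬Ph Plo)
  ...   | inj₁ (s≤s lo≤h) with greatest-≤ lo h lo≤h Plo
  ...     | z , lo≤z , z≤h , Pz , above = z , lo≤z , m≤n⇒m≤1+n z≤h , Pz , above′
    where
    above′ : ∀ w → z < w → w ≤ suc h → ¬ P w
    above′ w z<w w≤ with m≤n⇒m<n∨m≡n w≤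
    ... | inj₁ (s≤s w≤h) = above w z<w w≤h
    ... | inj₂ refl = ¬Ph

  least-≥ : ∀ lo hi → lo ≤ hi → P hi →
    Σ ℕ λ z → lo ≤ z × z ≤ hi × P z × (∀ w → lo ≤ w → w < z → ¬ P w)
  least-≥ lo hi lo≤hi = search (hi ∸ lo) lo (sym (m∸n+n≡m lo≤hi))
    where
    search : ∀ d lo → hi ≡ d + lo → P hi →
      Σ ℕ λ z → lo ≤ z × z ≤ hi × P z × (∀ w → lo ≤ w → w < z → ¬ P w)
    search zero lo refl Phi = hi , ≤-refl , ≤-refl , Phi , λ w lo≤w w<z _ → <⇒≱ w<z lo≤w
    search (suc d) lo hi≡ Phi with P? lo
    ... | yes Plo = lo , ≤-refl , ≤-trans (m≤n+m lo (suc d)) (≤-reflexive (sym hi≡)) , Plo ,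
                    λ w lo≤w w<z _ → <⇒≱ w<z lo≤w
    ... | no ¬Plo with search d (suc lo) (trans hi≡ (sym (+-suc d lo))) Phi
    ...   | z , lo<z , z≤hi , Pz , below = z , <⇒≤ lo<z , z≤hi , Pz , below′
      where
      below′ : ∀ w → lo ≤ w → w < z → ¬ P w
      below′ w lo≤w w<z with m≤n⇒m<n∨m≡n lo≤w
      ... | inj₁ lo<w = below w lo<w w<z
      ... | inj₂ refl = ¬Plo

module _ {A : Set} where

  head≡just⇒ : ∀ {xs : List A} {x} → head xs ≡ just x → Σ (List A) λ ys → xs ≡ x ∷ ys
  head≡just⇒ {_ ∷ ys} refl = ys , refl

  last≡just⇒ : ∀ {xs : List A} {x} → last xs ≡ just x → Σ (List A) λ ys → xs ≡ ys ++ x ∷ []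
  last≡just⇒ {_ ∷ []} refl = [] , refl
  last≡just⇒ {u ∷ v ∷ xs} eq with last≡just⇒ {v ∷ xs} eq
  ... | ys , xs≡ = u ∷ ys , cong (u ∷_) xs≡

  head∈ : ∀ {xs : List A} {x} → head xs ≡ just x → x ∈ xs
  head∈ {_ ∷ _} refl = here refl

  last∈ : ∀ {xs : List A} {x} → last xs ≡ just x → x ∈ xs
  last∈ {_ ∷ []} refl = here refl
  last∈ {_ ∷ v ∷ xs} eq = there (last∈ {v ∷ xs} eq)

  head-++ : ∀ {xs : List A} {x} ys → head xs ≡ just x → head (xs ++ ys) ≡ just x
  head-++ {_ ∷ _} _ eq = eq

  head-++-∷ : ∀ (xs : List A) y ys zs → head (xs ++ y ∷ ys) ≡ head (xs ++ y ∷ zs)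
  head-++-∷ [] _ _ _ = refl
  head-++-∷ (_ ∷ _) _ _ _ = refl

  last-++-∷ : ∀ (xs : List A) y ys → last (xs ++ y ∷ ys) ≡ last (y ∷ ys)
  last-++-∷ [] _ _ = refl
  last-++-∷ (_ ∷ []) _ _ = refl
  last-++-∷ (_ ∷ x ∷ xs) y ys = last-++-∷ (x ∷ xs) y ys

  last-++-∷ʳ : ∀ (xs : List A) y → last (xs ++ y ∷ []) ≡ just y
  last-++-∷ʳ xs y = last-++-∷ xs y []

  AllPairs-split : ∀ {R : Rel A 0ℓ} xs {y zs} → AllPairs R (xs ++ y ∷ zs) →
                   All (λ x → R x y) xs × All (R y) zs
  AllPairs-split [] (ry ∷ _) = [] , ry
  AllPairs-split (x ∷ xs) (rx ∷ rxs) with AllPairs-split xs rxs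
  ... | left , right = All.lookup rx (∈-++⁺ʳ xs (here refl)) ∷ left , right

sorted-lookup : ∀ {R : Rel ℕ 0ℓ} {F u v} → AllPairs _<_ F → AllPairs R F →
                u ∈ F → v ∈ F → u < v → R u v
sorted-lookup (_ ∷ _) _ (here refl) (here refl) u<v = ⊥-elim (<-irrefl refl u<v)
sorted-lookup (_ ∷ _) (Ru ∷ _) (here refl) (there v∈) _ = All.lookup Ru v∈
sorted-lookup (<v ∷ _) _ (there u∈) (here refl) u<v = ⊥-elim (<-asym u<v (All.lookup <v u∈))
sorted-lookup (_ ∷ sorted) (_ ∷ R-F) (there u∈) (there v∈) u<v = sorted-lookup sorted R-F u∈ v∈ u<v

head≤ : ∀ {F a z} → AllPairs _<_ F → head F ≡ just a → z ∈ F → a ≤ z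
head≤ (_ ∷ _) refl (here refl) = ≤-refl
head≤ (a< ∷ _) refl (there z∈) = <⇒≤ (All.lookup a< z∈)

≤last : ∀ {F c z} → AllPairs _<_ F → last F ≡ just c → z ∈ F → z ≤ c
≤last {_ ∷ []} _ refl (here refl) = ≤-refl
≤last {_ ∷ _ ∷ _} (u< ∷ sorted) eq (here refl) =
  ≤-trans (<⇒≤ (All.lookup u< (here refl))) (≤last sorted eq (here refl))
≤last {_ ∷ _ ∷ _} (_ ∷ sorted) eq (there z∈) = ≤last sorted eq z∈

∈-pairs⁻ : ∀ {F s t} → (s , t) ∈ pairs F → s ∈ F × t ∈ F
∈-pairs⁻ {_ ∷ _ ∷ _} (here refl) = here refl , there (here refl)
∈-pairs⁻ {_ ∷ y ∷ F} (there p) with ∈-pairs⁻ {y ∷ F} p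
... | s∈ , t∈ = there s∈ , there t∈

pairs-< : ∀ {F s t} → AllPairs _<_ F → (s , t) ∈ pairs F → s < t
pairs-< {_ ∷ _ ∷ _} (x< ∷ _) (here refl) = All.lookup x< (here refl)
pairs-< {_ ∷ _ ∷ _} (_ ∷ sorted) (there p) = pairs-< sorted p

pairs-adjacent : ∀ {F s t z} → AllPairs _<_ F → (s , t) ∈ pairs F → z ∈ F → s < z → z < t → ⊥
pairs-adjacent {_ ∷ _ ∷ _} _ (here refl) (here refl) s<z _ = <-irrefl refl s<z
pairs-adjacent {_ ∷ _ ∷ _} _ (here refl) (there (here refl)) _ z<t = <-irrefl refl z<t
pairs-adjacent {_ ∷ _ ∷ _} (_ ∷ t< ∷ _) (here refl) (there (there z∈)) _ z<t = <-asym z<t (All.lookup t< z∈)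
pairs-adjacent {_ ∷ y ∷ F} (x< ∷ _) (there p) (here refl) s<z _ =
  <-asym s<z (All.lookup x< (proj₁ (∈-pairs⁻ {y ∷ F} p)))
pairs-adjacent {_ ∷ _ ∷ _} (_ ∷ sorted) (there p) (there z∈) s<z z<t = pairs-adjacent sorted p z∈ s<z z<t

adjacent⇒∈-pairs : ∀ {F s t} → AllPairs _<_ F → s ∈ F → t ∈ F → s < t →
                   (∀ z → z ∈ F → s < z → z < t → ⊥) → (s , t) ∈ pairs F
adjacent⇒∈-pairs {_ ∷ []} _ (here refl) (here refl) s<t _ = ⊥-elim (<-irrefl refl s<t)
adjacent⇒∈-pairs {_ ∷ _ ∷ _} _ (here refl) (here refl) s<t _ = ⊥-elim (<-irrefl refl s<t)
adjacent⇒∈-pairs {_ ∷ _ ∷ _} _ (here refl) (there (here refl)) _ _ = here refl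
adjacent⇒∈-pairs {_ ∷ y ∷ _} (s< ∷ y< ∷ _) (here refl) (there (there t∈)) _ between =
  ⊥-elim (between y (there (here refl)) (All.lookup s< (here refl)) (All.lookup y< t∈))
adjacent⇒∈-pairs {_ ∷ _ ∷ _} (t< ∷ _) (there s∈) (here refl) s<t _ = ⊥-elim (<-asym s<t (All.lookup t< s∈))
adjacent⇒∈-pairs {_ ∷ _ ∷ _} (_ ∷ sorted) (there s∈) (there t∈) s<t between =
  there (adjacent⇒∈-pairs sorted s∈ t∈ s<t (λ z z∈ → between z (there z∈)))

pairs-sorted : ∀ {F} → AllPairs _<_ F → AllPairs (λ p q → proj₁ p < proj₁ q) (pairs F)
pairs-sorted {[]} _ = []
pairs-sorted {_ ∷ []} _ = []
pairs-sorted {_ ∷ y ∷ F} (x< ∷ sorted) =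
  All.tabulate (λ {q} q∈ → All.lookup x< (proj₁ (∈-pairs⁻ {y ∷ F} q∈))) ∷ pairs-sorted sorted

pairs-suffix : ∀ (F : List ℕ) L {x y R} → pairs F ≡ L ++ (x , y) ∷ R →
  Σ (List ℕ) λ G → R ≡ pairs (y ∷ G) × last (y ∷ G) ≡ last F
pairs-suffix (_ ∷ _ ∷ F) [] refl = F , refl , refl
pairs-suffix (_ ∷ v ∷ F) (_ ∷ L) eq = pairs-suffix (v ∷ F) L (proj₂ (∷-injective eq))

-- The combinatorial part of the argument uses only these closure properties of conserved
-- intervals; they are established for families of signed permutations further below.
module IntervalCalculus
  (n : ℕ) (Ps : Family) (b : ℕ)
  (conserved-bounds : ∀ {a c} → Conserved n Ps a c → a ≤ c × 1 ≤ a × c ≤ n)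
  (conserved-∪ : ∀ {i k j l} → i < k → k ≤ j → j < l →
                 Conserved n Ps i j → Conserved n Ps k l → Conserved n Ps i l)
  (conserved-∖ˡ : ∀ {a m c} → a < m → m < c →
                  Conserved n Ps a c → Conserved n Ps a m → Conserved n Ps m c)
  (conserved-∖ʳ : ∀ {a m c} → a < m → m < c →
                  Conserved n Ps a c → Conserved n Ps m c → Conserved n Ps a m)
  (conserved? : ∀ a c → Dec (Conserved n Ps a c))
  where

  C : ℕ → ℕ → Set
  C = Conserved n Ps

  conserved-≤ : ∀ {a c} → C a c → a ≤ c
  conserved-≤ Cac = proj₁ (conserved-bounds Cac)

  singletonˡ : ∀ {a c} → C a c → C a a
  singletonˡ Cac with conserved-bounds Cac
  ... | a≤c , 1≤a , c≤n = inj₁ (refl , 1≤a , ≤-trans a≤c c≤n)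

  singletonʳ : ∀ {a c} → C a c → C c c
  singletonʳ Cac with conserved-bounds Cac
  ... | a≤c , 1≤a , c≤n = inj₁ (refl , ≤-trans 1≤a a≤c , c≤n)

  conserved-concat : ∀ {a m c} → a ≤ m → m ≤ c → C a m → C m c → C a c
  conserved-concat a≤m m≤c Cam Cmc with m≤n⇒m<n∨m≡n a≤m | m≤n⇒m<n∨m≡n m≤c
  ... | inj₂ refl | _ = Cmc
  ... | inj₁ _ | inj₂ refl = Cam
  ... | inj₁ a<m | inj₁ m<c = conserved-∪ a<m ≤-refl m<c Cam Cmc

  conserved-dropˡ : ∀ {a m c} → a ≤ m → m ≤ c → C a c → C a m → C m c
  conserved-dropˡ a≤m m≤c Cac Cam with m≤n⇒m<n∨m≡n a≤m | m≤n⇒m<n∨m≡n m≤c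
  ... | inj₂ refl | _ = Cac
  ... | inj₁ _ | inj₂ refl = singletonʳ Cac
  ... | inj₁ a<m | inj₁ m<c = conserved-∖ˡ a<m m<c Cac Cam

  conserved-dropʳ : ∀ {a m c} → a ≤ m → m ≤ c → C a c → C m c → C a m
  conserved-dropʳ a≤m m≤c Cac Cmc with m≤n⇒m<n∨m≡n a≤m | m≤n⇒m<n∨m≡n m≤c
  ... | inj₂ refl | _ = singletonˡ Cac
  ... | inj₁ _ | inj₂ refl = Cac
  ... | inj₁ a<m | inj₁ m<c = conserved-∖ʳ a<m m<c Cac Cmc

  nested-extendˡ : ∀ {u v c} → C v c → u < v → v ∸ u ≤ b → Nested n Ps b v c → Nested n Ps b u c
  nested-extendˡ {u} {v} {c} Cvc u<v v∸u≤b N =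
    step Cvc (<⇒≤ u<v) ≤-refl (inj₁ u<v) N
      (s≤s (≤-trans (≤-reflexive (∸-split (<⇒≤ u<v) (conserved-≤ Cvc))) (+-monoʳ-≤ (c ∸ v) v∸u≤b)))

  nested-extendʳ : ∀ {x y v} → C x y → y < v → v ∸ y ≤ b → Nested n Ps b x y → Nested n Ps b x v
  nested-extendʳ {x} {y} {v} Cxy y<v v∸y≤b N =
    step Cxy ≤-refl (<⇒≤ y<v) (inj₂ y<v) N
      (s≤s (≤-trans (≤-reflexive (trans (∸-split (conserved-≤ Cxy) (<⇒≤ y<v)) (+-comm (v ∸ y) (y ∸ x))))
                    (+-monoʳ-≤ (y ∸ x) v∸y≤b)))

  record Frontier (a c z : ℕ) : Set where
    constructor frontier
    field
      start≤ : a ≤ z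
      ≤end : z ≤ c
      conservedˡ : C a z
      conservedʳ : C z c
  open Frontier

  frontier? : ∀ a c z → Dec (Frontier a c z)
  frontier? a c z = map′ (λ ((p , q) , r , s) → frontier p q r s)
                         (λ (frontier p q r s) → (p , q) , r , s)
                         (((a ≤? z) ×-dec (z ≤? c)) ×-dec (conserved? a z ×-dec conserved? z c))
    where open import Relation.Nullary.Decidable using (map′)

  start-frontier : ∀ {a c} → C a c → Frontier a c a
  start-frontier Cac = frontier ≤-refl (conserved-≤ Cac) (singletonˡ Cac) Cac

  end-frontier : ∀ {a c} → C a c → Frontier a c c
  end-frontier Cac = frontier (conserved-≤ Cac) ≤-refl Cac (singletonʳ Cac)

  frontiers-conserved : ∀ {a c x y} → Frontier a c x → Frontier a c y → x ≤ y → C x y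
  frontiers-conserved Fx Fy x≤y = conserved-dropˡ (start≤ Fx) x≤y (conservedˡ Fy) (conservedˡ Fx)

  frontier-extend : ∀ {a c a' c'} → Frontier a c a' → C a' c' → a' ≤ c' → c' ≤ c → Frontier a c c'
  frontier-extend (frontier a≤a' _ Caa' Ca'c) Ca'c' a'≤c' c'≤c =
    frontier (≤-trans a≤a' a'≤c') c'≤c (conserved-concat a≤a' a'≤c' Caa' Ca'c')
             (conserved-dropˡ a'≤c' c'≤c Ca'c Ca'c')

  record Consecutive (a c x y : ℕ) : Set where
    constructor consecutive
    field
      frontierₗ : Frontier a c x
      frontierᵣ : Frontier a c y
      x<y : x < y
      gapless : ∀ z → x < z → z < y → ¬ Frontier a c z
  open Consecutive

  consecutive-conserved : ∀ {a c x y} → Consecutive a c x y → C x y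
  consecutive-conserved cs = frontiers-conserved (frontierₗ cs) (frontierᵣ cs) (<⇒≤ (x<y cs))

  consecutive-unique : ∀ {a c s t t'} → Consecutive a c s t → Consecutive a c s t' → t ≡ t'
  consecutive-unique {t = t} {t'} cs cs' with <-cmp t t'
  ... | tri< t<t' _ _ = ⊥-elim (gapless cs' t (x<y cs) t<t' (frontierᵣ cs))
  ... | tri≈ _ t≡t' _ = t≡t'
  ... | tri> _ _ t'<t = ⊥-elim (gapless cs t' (x<y cs') t'<t (frontierᵣ cs'))

  consecutive-disjoint : ∀ {a c s t x y} → Consecutive a c s t → Consecutive a c x y → s ≢ x →
                         t ≤ x ⊎ y ≤ s
  consecutive-disjoint {s = s} {t} {x} {y} cs cs' s≢x with <-cmp s x
  ... | tri≈ _ s≡x _ = ⊥-elim (s≢x s≡x)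
  ... | tri< s<x _ _ with t ≤? x
  ...   | yes t≤x = inj₁ t≤x
  ...   | no t≰x = ⊥-elim (gapless cs x s<x (≰⇒> t≰x) (frontierₗ cs'))
  consecutive-disjoint {s = s} {t} {x} {y} cs cs' _ | tri> _ _ x<s with y ≤? s
  ...   | yes y≤s = inj₂ y≤s
  ...   | no y≰s = ⊥-elim (gapless cs' s x<s (≰⇒> y≰s) (frontierₗ cs))

  consecutive-¬conservedˡ : ∀ {a c x y z} → Consecutive a c x y → x < z → z < y → ¬ C x z
  consecutive-¬conservedˡ {z = z} cs@(consecutive Fx Fy _ between) x<z z<y Cxz =
    between z x<z z<y
      (frontier (≤-trans (start≤ Fx) (<⇒≤ x<z)) (≤-trans (<⇒≤ z<y) (≤end Fy))
        (conserved-concat (start≤ Fx) (<⇒≤ x<z) (conservedˡ Fx) Cxz)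
        (conserved-concat (<⇒≤ z<y) (≤end Fy)
          (conserved-dropˡ (<⇒≤ x<z) (<⇒≤ z<y) (consecutive-conserved cs) Cxz) (conservedʳ Fy)))

  consecutive-¬conservedʳ : ∀ {a c x y z} → Consecutive a c x y → x < z → z < y → ¬ C z y
  consecutive-¬conservedʳ cs x<z z<y Czy = consecutive-¬conservedˡ cs x<z z<y
    (conserved-dropʳ (<⇒≤ x<z) (<⇒≤ z<y) (consecutive-conserved cs) Czy)

  ends-before-next-frontier : ∀ {a c x y k l} → Consecutive a c x y → x < k → k < y → C k l → l < y
  ends-before-next-frontier {y = y} {l = l} cs x<k k<y Ckl with <-cmp l y
  ... | tri< l<y _ _ = l<y
  ... | tri≈ _ refl _ = ⊥-elim (consecutive-¬conservedʳ cs x<k k<y Ckl)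
  ... | tri> _ _ y<l = ⊥-elim (consecutive-¬conservedˡ cs x<k k<y
          (conserved-∖ʳ x<k (<-trans k<y y<l)
            (conserved-∪ x<k (<⇒≤ k<y) y<l (consecutive-conserved cs) Ckl) Ckl))

  starts-after-previous-frontier : ∀ {a c x y k l} → Consecutive a c x y → x < l → l < y → C k l → x < k
  starts-after-previous-frontier {x = x} {k = k} cs x<l l<y Ckl with <-cmp x k
  ... | tri< x<k _ _ = x<k
  ... | tri≈ _ refl _ = ⊥-elim (consecutive-¬conservedˡ cs x<l l<y Ckl)
  ... | tri> _ _ k<x = ⊥-elim (consecutive-¬conservedʳ cs x<l l<y
          (conserved-∖ˡ (<-trans k<x x<l) l<y
            (conserved-∪ k<x (<⇒≤ x<l) l<y Ckl (consecutive-conserved cs)) Ckl))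

  GapFree : ℕ → ℕ → Set
  GapFree a c = ∀ x y → Consecutive a c x y → ¬ Gap b (x , y)

  OneGoodGap : ℕ → ℕ → Set
  OneGoodGap a c = Σ ℕ λ x → Σ ℕ λ y →
    Consecutive a c x y × Gap b (x , y) × GoodGap n Ps b (x , y) ×
    (∀ s t → Consecutive a c s t → s ≢ x → ¬ Gap b (s , t))

  GapCondition : ℕ → ℕ → Set
  GapCondition a c = GapFree a c ⊎ OneGoodGap a c

  ≤⇒¬Gap : ∀ {x y} → y ∸ x ≤ b → ¬ Gap b (x , y)
  ≤⇒¬Gap y∸x≤b (s≤s b<y∸x) = <⇒≱ b<y∸x y∸x≤b

  ¬Gap⇒≤ : ∀ {x y} → ¬ Gap b (x , y) → y ∸ x ≤ b
  ¬Gap⇒≤ ¬gap = ≮⇒≥ λ b<y∸x → ¬gap (s≤s b<y∸x)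

  -- The frontiers of (a..c) between two of its frontiers a' ≤ c' are those of (a'..c');
  -- all other consecutive pairs lie in the margins, which are no wider than b.
  module InnerFrontiers {a c a' c'} (a'≤c' : a' ≤ c') (Fa' : Frontier a c a') (Fc' : Frontier a c c')
                        (defect : c ∸ a ≤ (c' ∸ a') + b) where

    inner⇒outer : ∀ {z} → Frontier a' c' z → Frontier a c z
    inner⇒outer (frontier a'≤z z≤c' Ca'z Czc') =
      frontier (≤-trans (start≤ Fa') a'≤z) (≤-trans z≤c' (≤end Fc'))
        (conserved-concat (start≤ Fa') a'≤z (conservedˡ Fa') Ca'z)
        (conserved-concat z≤c' (≤end Fc') Czc' (conservedʳ Fc'))

    outer⇒inner : ∀ {z} → a' ≤ z → z ≤ c' → Frontier a c z → Frontier a' c' z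
    outer⇒inner a'≤z z≤c' (frontier _ _ Caz Czc) =
      frontier a'≤z z≤c' (conserved-dropˡ (start≤ Fa') a'≤z Caz (conservedˡ Fa'))
                         (conserved-dropʳ z≤c' (≤end Fc') Czc (conservedʳ Fc'))

    consecutive-inner⇒outer : ∀ {x y} → Consecutive a' c' x y → Consecutive a c x y
    consecutive-inner⇒outer (consecutive Fx Fy x<y between) =
      consecutive (inner⇒outer Fx) (inner⇒outer Fy) x<y λ z x<z z<y Fz →
        between z x<z z<y (outer⇒inner (≤-trans (start≤ Fx) (<⇒≤ x<z)) (≤-trans (<⇒≤ z<y) (≤end Fy)) Fz)

    outer-pair : ∀ {s t} → Consecutive a c s t → ¬ Gap b (s , t) ⊎ Consecutive a' c' s t
    outer-pair {s} {t} (consecutive Fs Ft s<t between) with t ≤? a'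
    ... | yes t≤a' = inj₁ (≤⇒¬Gap {s} {t} (≤-trans (∸-mono t≤a' (start≤ Fs))
                                            (marginˡ≤ (start≤ Fa') a'≤c' (≤end Fc') defect)))
    ... | no t≰a' with s <? a'
    ...   | yes s<a' = ⊥-elim (between a' s<a' (≰⇒> t≰a') Fa')
    ...   | no s≮a' with c' ≤? s
    ...     | yes c'≤s = inj₁ (≤⇒¬Gap {s} {t} (≤-trans (∸-mono (≤end Ft) c'≤s)
                                              (marginʳ≤ (start≤ Fa') a'≤c' (≤end Fc') defect)))
    ...     | no c'≰s with c' <? t
    ...       | yes c'<t = ⊥-elim (between c' (≰⇒> c'≰s) c'<t Fc')
    ...       | no c'≮t = inj₂ (consecutive (outer⇒inner a'≤s (<⇒≤ (≰⇒> c'≰s)) Fs)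
                                            (outer⇒inner (≤-trans a'≤s (<⇒≤ s<t)) (≮⇒≥ c'≮t) Ft) s<t
                                            λ z s<z z<t Fz → between z s<z z<t (inner⇒outer Fz))
      where
      a'≤s : a' ≤ s
      a'≤s = ≮⇒≥ s≮a'

    gap-condition-outer : GapCondition a' c' → GapCondition a c
    gap-condition-outer (inj₁ gapFree) = inj₁ λ s t cs → [ id , gapFree s t ]′ (outer-pair cs)
    gap-condition-outer (inj₂ (x , y , cs , gap , good , others)) =
      inj₂ (x , y , consecutive-inner⇒outer cs , gap , good ,
            λ s t cs′ s≢x → [ id , (λ cs″ → others s t cs″ s≢x) ]′ (outer-pair cs′))

  consecutive-around : ∀ {a c a' c'} → ¬ Frontier a c a' → a ≤ a' → c' ≤ c → C a c → C a' c' →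
                       Σ ℕ λ x → Σ ℕ λ y → Consecutive a c x y × x < a' × c' < y
  consecutive-around {a} {c} {a'} {c'} ¬Fa' a≤a' c'≤c Cac Ca'c'
    with greatest-≤ (frontier? a c) a a' a≤a' (start-frontier Cac)
       | least-≥ (frontier? a c) a' c (≤-trans (conserved-≤ Ca'c') c'≤c) (end-frontier Cac)
  ... | x , _ , x≤a' , Fx , above | y , a'≤y , _ , Fy , below =
        x , y , cs , x<a' , ends-before-next-frontier cs x<a' a'<y Ca'c'
    where
    x<a' : x < a'
    x<a' = ≤∧≢⇒< x≤a' λ { refl → ¬Fa' Fx }
    a'<y : a' < y
    a'<y = ≤∧≢⇒< a'≤y λ { refl → ¬Fa' Fy }
    cs : Consecutive a c x y
    cs = consecutive Fx Fy (<-trans x<a' a'<y) λ w x<w w<y Fw → case w ≤? a' of λ where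
      (yes w≤a') → above w x<w w≤a' Fw
      (no w≰a') → below w (<⇒≤ (≰⇒> w≰a')) w<y Fw

  overlap? : ∀ i j k l → Dec (Overlap i j k l)
  overlap? i j k l = ((i <? k) ×-dec ((k ≤? j) ×-dec (j <? l))) ⊎-dec
                     ((k <? i) ×-dec ((i ≤? l) ×-dec (l <? j)))

  OverlappedBelow : ℕ → ℕ → Set
  OverlappedBelow i j = ∃ λ k → k < suc n × ∃ λ l → l < suc n × C k l × Overlap i j k l

  overlapped? : ∀ i j → Dec (OverlappedBelow i j)
  overlapped? i j =
    anyUpTo? (λ k → anyUpTo? (λ l → conserved? k l ×-dec overlap? i j k l) (suc n)) (suc n)

  module GrowInsideGap {a c x y} (cs : Consecutive a c x y) (gap : b < y ∸ x) where

    -- Replacing (m₁..m₂) by its union with an overlapping conserved interval keeps it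
    -- b-nested and inside (x..y) while strictly widening it; the width of (x..y) bounds
    -- the number of steps, after which (m₁..m₂) is strong.
    grow : ∀ fuel m₁ m₂ → x < m₁ → m₂ < y → C m₁ m₂ → Nested n Ps b m₁ m₂ →
           y ∸ x ≤ (m₂ ∸ m₁) + b → y ∸ x ≤ (m₂ ∸ m₁) + fuel → GoodGap n Ps b (x , y)
    grow zero m₁ m₂ x<m₁ m₂<y C₁₂ _ _ out-of-fuel =
      ⊥-elim (<⇒≱ (<-≤-trans (∸-monoʳ-< x<m₁ (conserved-≤ C₁₂)) (∸-monoˡ-≤ x (<⇒≤ m₂<y)))
                  (≤-trans out-of-fuel (≤-reflexive (+-identityʳ _))))
    grow (suc fuel) m₁ m₂ x<m₁ m₂<y C₁₂ N₁₂ defect fuel-bound with overlapped? m₁ m₂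
    ... | no ¬overlapped =
          m₁ , m₂ , (C₁₂ , s≤s nonempty , strong) , N₁₂ , x<m₁ , conserved-≤ C₁₂ , m₂<y , s≤s defect
      where
      nonempty : 1 ≤ m₂ ∸ m₁
      nonempty = ≰⇒> λ empty → <⇒≱ gap (≤-trans defect (+-monoˡ-≤ b empty))
      strong : ∀ k l → C k l → ¬ Overlap m₁ m₂ k l
      strong k l Ckl ov with conserved-bounds Ckl
      ... | k≤l , _ , l≤n = ¬overlapped (k , s≤s (≤-trans k≤l l≤n) , l , s≤s l≤n , Ckl , ov)
    ... | yes (k , _ , l , _ , Ckl , inj₁ (m₁<k , k≤m₂ , m₂<l)) =
          grow fuel m₁ l x<m₁ l<y (conserved-∪ m₁<k k≤m₂ m₂<l C₁₂ Ckl)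
            (step C₁₂ ≤-refl (<⇒≤ m₂<l) (inj₂ m₂<l) N₁₂
              (s≤s (≤-trans (∸-mono (<⇒≤ l<y) (<⇒≤ x<m₁)) defect)))
            (≤-trans defect (+-monoˡ-≤ b (∸-monoˡ-≤ m₁ (<⇒≤ m₂<l))))
            (≤-trans fuel-bound (≤-trans (≤-reflexive (+-suc (m₂ ∸ m₁) fuel))
                                         (+-monoˡ-≤ fuel (∸-monoˡ-< m₂<l (conserved-≤ C₁₂)))))
      where
      l<y : l < y
      l<y = ends-before-next-frontier cs (<-trans x<m₁ m₁<k) (≤-<-trans k≤m₂ m₂<y) Ckl
    ... | yes (k , _ , l , _ , Ckl , inj₂ (k<m₁ , m₁≤l , l<m₂)) =
          grow fuel k m₂ x<k m₂<y (conserved-∪ k<m₁ m₁≤l l<m₂ Ckl C₁₂)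
            (step C₁₂ (<⇒≤ k<m₁) ≤-refl (inj₁ k<m₁) N₁₂
              (s≤s (≤-trans (∸-mono (<⇒≤ m₂<y) (<⇒≤ x<k)) defect)))
            (≤-trans defect (+-monoˡ-≤ b (∸-monoʳ-≤ m₂ (<⇒≤ k<m₁))))
            (≤-trans fuel-bound (≤-trans (≤-reflexive (+-suc (m₂ ∸ m₁) fuel))
                                         (+-monoˡ-≤ fuel (∸-monoʳ-< k<m₁ (conserved-≤ C₁₂)))))
      where
      x<k : x < k
      x<k = starts-after-previous-frontier cs (<-≤-trans x<m₁ m₁≤l) (<-trans l<m₂ m₂<y) Ckl

  nested⇒gap-condition : ∀ {a c} → Nested n Ps b a c → C a c → GapCondition a c
  nested⇒gap-condition (single a) _ =
    inj₁ λ x y (consecutive Fx Fy x<y _) _ → <⇒≱ x<y (≤-trans (≤end Fy) (start≤ Fx))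
  nested⇒gap-condition {a} {c} (step {a' = a'} {c' = c'} Ca'c' a≤a' c'≤c _ N sz) Cac with frontier? a c a'
  ... | yes Fa' = InnerFrontiers.gap-condition-outer (conserved-≤ Ca'c') Fa'
                    (frontier-extend Fa' Ca'c' (conserved-≤ Ca'c') c'≤c) (s≤s⁻¹ sz)
                    (nested⇒gap-condition N Ca'c')
  ... | no ¬Fa' with consecutive-around ¬Fa' a≤a' c'≤c Cac Ca'c'
  ...   | x , y , cs , x<a' , c'<y = result
    where
    a'≤c' : a' ≤ c'
    a'≤c' = conserved-≤ Ca'c'
    defect : c ∸ a ≤ (c' ∸ a') + b
    defect = s≤s⁻¹ sz
    others : ∀ s t → Consecutive a c s t → s ≢ x → ¬ Gap b (s , t)
    others s t cs′ s≢x with consecutive-disjoint cs′ cs s≢x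
    ... | inj₁ t≤x = ≤⇒¬Gap {s} {t}
          (≤-trans (∸-mono (≤-trans t≤x (<⇒≤ x<a')) (start≤ (frontierₗ cs′))) (marginˡ≤ a≤a' a'≤c' c'≤c defect))
    ... | inj₂ y≤s = ≤⇒¬Gap {s} {t}
          (≤-trans (∸-mono (≤end (frontierᵣ cs′)) (≤-trans (<⇒≤ c'<y) y≤s)) (marginʳ≤ a≤a' a'≤c' c'≤c defect))
    result : GapCondition a c
    result with suc b <? size x y
    ... | yes gap = inj₂ (x , y , cs , gap ,
            GrowInsideGap.grow cs (s≤s⁻¹ gap) (y ∸ x) a' c' x<a' c'<y Ca'c' N
              (≤-trans (∸-mono (≤end (frontierᵣ cs)) (start≤ (frontierₗ cs))) defect) (m≤n+m _ _) ,
            others)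
    ... | no ¬gap = inj₁ λ s t cs′ → case s ≟ x of λ where
            (yes refl) → subst (λ t → ¬ Gap b (s , t)) (sym (consecutive-unique cs′ cs)) ¬gap
            (no s≢x) → others s t cs′ s≢x

  module MaxFrontiers {a c : ℕ} (Cac : C a c) (F : List ℕ) (maxF : IsMaxFrontiers n Ps a c F) where

    sorted : AllPairs _<_ F
    sorted = proj₁ (proj₁ maxF)
    head≡a : head F ≡ just a
    head≡a = proj₁ (proj₂ (proj₁ maxF))
    last≡c : last F ≡ just c
    last≡c = proj₁ (proj₂ (proj₂ (proj₁ maxF)))
    pairwise-conserved : AllPairs C F
    pairwise-conserved = proj₂ (proj₂ (proj₂ (proj₁ maxF)))

    ∈⇒frontier : ∀ {z} → z ∈ F → Frontier a c z
    ∈⇒frontier {z} z∈ = frontier a≤z z≤c Caz Czc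
      where
      a≤z : a ≤ z
      a≤z = head≤ sorted head≡a z∈
      z≤c : z ≤ c
      z≤c = ≤last sorted last≡c z∈
      Caz : C a z
      Caz with m≤n⇒m<n∨m≡n a≤z
      ... | inj₂ refl = singletonˡ Cac
      ... | inj₁ a<z = sorted-lookup sorted pairwise-conserved (head∈ head≡a) z∈ a<z
      Czc : C z c
      Czc with m≤n⇒m<n∨m≡n z≤c
      ... | inj₂ refl = singletonʳ Cac
      ... | inj₁ z<c = sorted-lookup sorted pairwise-conserved z∈ (last∈ {xs = F} last≡c) z<c

    -- A frontier z is in F because inserting it into F yields a set of frontiers ⊇ F.
    module Insert {z} (Fz : Frontier a c z) (a<z : a < z) (z<c : z < c) where

      below above : List ℕ → List ℕ
      below = filter (_<? z)
      above = filter (z <?_)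

      F+z : List ℕ
      F+z = below F ++ z ∷ above F

      ∈-below⁻ : ∀ {u} → u ∈ below F → u ∈ F × u < z
      ∈-below⁻ = ∈-filter⁻ (_<? z) {xs = F}
      ∈-above⁻ : ∀ {u} → u ∈ above F → u ∈ F × z < u
      ∈-above⁻ = ∈-filter⁻ (z <?_) {xs = F}

      F+z-sorted : AllPairs _<_ F+z
      F+z-sorted = AllPairs.++⁺ (AllPairs.filter⁺ (_<? z) sorted)
        (All.tabulate (λ v∈ → proj₂ (∈-above⁻ v∈)) ∷ AllPairs.filter⁺ (z <?_) sorted)
        (All.tabulate λ u∈ → proj₂ (∈-below⁻ u∈) ∷
           All.tabulate λ v∈ → <-trans (proj₂ (∈-below⁻ u∈)) (proj₂ (∈-above⁻ v∈)))

      F+z-conserved : AllPairs C F+z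
      F+z-conserved = AllPairs.++⁺ (AllPairs.filter⁺ (_<? z) pairwise-conserved)
        (All.tabulate (λ v∈ → let (v∈F , z<v) = ∈-above⁻ v∈ in frontiers-conserved Fz (∈⇒frontier v∈F) (<⇒≤ z<v))
           ∷ AllPairs.filter⁺ (z <?_) pairwise-conserved)
        (All.tabulate λ u∈ → let (u∈F , u<z) = ∈-below⁻ u∈ in
           frontiers-conserved (∈⇒frontier u∈F) Fz (<⇒≤ u<z) ∷
           All.tabulate λ v∈ → let (v∈F , z<v) = ∈-above⁻ v∈ in
             sorted-lookup sorted pairwise-conserved u∈F v∈F (<-trans u<z z<v))

      F+z-head : head F+z ≡ just a
      F+z-head with head≡just⇒ {xs = F} head≡a
      ... | F′ , F≡ = trans (cong (λ X → head (below X ++ z ∷ above F)) F≡)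
                            (cong (λ X → head (X ++ z ∷ above F)) (filter-accept (_<? z) a<z))

      F+z-last : last F+z ≡ just c
      F+z-last with last≡just⇒ {xs = F} last≡c
      ... | F′ , F≡ = begin
        last (below F ++ z ∷ above F)              ≡⟨ last-++-∷ (below F) z (above F) ⟩
        last (z ∷ above F)                         ≡⟨ cong (λ X → last (z ∷ above X)) F≡ ⟩
        last (z ∷ above (F′ ++ c ∷ []))            ≡⟨ cong (λ X → last (z ∷ X)) (filter-++ (z <?_) F′ (c ∷ [])) ⟩
        last (z ∷ (above F′ ++ above (c ∷ [])))    ≡⟨ cong (λ X → last (z ∷ (above F′ ++ X)))
                                                          (filter-accept (z <?_) {xs = []} z<c) ⟩
        last ((z ∷ above F′) ++ c ∷ [])            ≡⟨ last-++-∷ʳ (z ∷ above F′) c ⟩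
        just c                                      ∎
        where open ≡-Reasoning

      F⊆F+z : ∀ {u} → u ∈ F → u ∈ F+z
      F⊆F+z {u} u∈ with <-cmp u z
      ... | tri< u<z _ _ = ∈-++⁺ˡ (∈-filter⁺ (_<? z) u∈ u<z)
      ... | tri≈ _ refl _ = ∈-++⁺ʳ (below F) (here refl)
      ... | tri> _ _ z<u = ∈-++⁺ʳ (below F) (there (∈-filter⁺ (z <?_) u∈ z<u))

      z∈F : z ∈ F
      z∈F = proj₂ maxF F+z (F+z-sorted , F+z-head , F+z-last , F+z-conserved) F⊆F+z
                      (∈-++⁺ʳ (below F) (here refl))

    frontier⇒∈ : ∀ {z} → Frontier a c z → z ∈ F
    frontier⇒∈ {z} Fz with m≤n⇒m<n∨m≡n (start≤ Fz) | m≤n⇒m<n∨m≡n (≤end Fz)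
    ... | inj₂ refl | _ = head∈ head≡a
    ... | inj₁ _ | inj₂ refl = last∈ {xs = F} last≡c
    ... | inj₁ a<z | inj₁ z<c = Insert.z∈F Fz a<z z<c

    ∈-pairs⇒consecutive : ∀ {s t} → (s , t) ∈ pairs F → Consecutive a c s t
    ∈-pairs⇒consecutive p with ∈-pairs⁻ {F} p
    ... | s∈F , t∈F = consecutive (∈⇒frontier s∈F) (∈⇒frontier t∈F) (pairs-< sorted p)
                        λ z s<z z<t Fz → pairs-adjacent sorted p (frontier⇒∈ Fz) s<z z<t

    consecutive⇒∈-pairs : ∀ {s t} → Consecutive a c s t → (s , t) ∈ pairs F
    consecutive⇒∈-pairs (consecutive Fs Ft s<t between) =
      adjacent⇒∈-pairs sorted (frontier⇒∈ Fs) (frontier⇒∈ Ft) s<t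
        λ z z∈ s<z z<t → between z s<z z<t (∈⇒frontier z∈)

    gap-condition⇒gaps : GapCondition a c → NoGap b F ⊎ ExactlyOneGoodGap n Ps b F
    gap-condition⇒gaps (inj₁ gapFree) =
      inj₁ (All.tabulate λ {q} p → gapFree (proj₁ q) (proj₂ q) (∈-pairs⇒consecutive p))
    gap-condition⇒gaps (inj₂ (x , y , cs , gap , good , others)) with ∈-∃++ (consecutive⇒∈-pairs cs)
    ... | L , R , pairs≡ = inj₂ (L , (x , y) , R , pairs≡ , gapFreeˡ , gapFreeʳ , gap , good)
      where
      before-after : All (λ q → proj₁ q < x) L × All (λ q → x < proj₁ q) R
      before-after = AllPairs-split L (subst (AllPairs (λ p q → proj₁ p < proj₁ q)) pairs≡ (pairs-sorted sorted))
      gapFreeˡ : All (λ q → ¬ Gap b q) L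
      gapFreeˡ = All.tabulate λ {q} q∈ →
        others (proj₁ q) (proj₂ q) (∈-pairs⇒consecutive (subst (q ∈_) (sym pairs≡) (∈-++⁺ˡ q∈)))
               (<⇒≢ (All.lookup (proj₁ before-after) q∈))
      gapFreeʳ : All (λ q → ¬ Gap b q) R
      gapFreeʳ = All.tabulate λ {q} q∈ →
        others (proj₁ q) (proj₂ q) (∈-pairs⇒consecutive (subst (q ∈_) (sym pairs≡) (∈-++⁺ʳ L (there q∈))))
               (λ q≡x → <⇒≢ (All.lookup (proj₂ before-after) q∈) (sym q≡x))

    walkˡ : ∀ H L {x y R} u → head H ≡ just u → pairs H ≡ L ++ (x , y) ∷ R →
            (∀ {p} → p ∈ pairs H → p ∈ pairs F) → All (λ q → ¬ Gap b q) L →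
            Nested n Ps b x c → Nested n Ps b u c
    walkˡ (_ ∷ []) [] _ refl () _ _ _
    walkˡ (_ ∷ []) (_ ∷ _) _ refl () _ _ _
    walkˡ (_ ∷ _ ∷ _) [] _ refl pairs≡ _ _ N with ∷-injective pairs≡
    ... | refl , _ = N
    walkˡ (u ∷ v ∷ H) (_ ∷ L) u refl pairs≡ ⊆F (¬gap ∷ ¬gaps) N with ∷-injective pairs≡
    ... | refl , pairs≡′ =
          nested-extendˡ (conservedʳ (frontierᵣ cs)) (x<y cs) (¬Gap⇒≤ {u} {v} ¬gap)
            (walkˡ (v ∷ H) L v refl pairs≡′ (λ p∈ → ⊆F (there p∈)) ¬gaps N)
      where
      cs : Consecutive a c u v
      cs = ∈-pairs⇒consecutive (⊆F (here refl))

    walkʳ : ∀ G {x} y → x ≤ y → Frontier a c x → (∀ {p} → p ∈ pairs (y ∷ G) → p ∈ pairs F) →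
            All (λ q → ¬ Gap b q) (pairs (y ∷ G)) → last (y ∷ G) ≡ just c →
            Nested n Ps b x y → Nested n Ps b x c
    walkʳ [] _ _ _ _ _ refl N = N
    walkʳ (v ∷ G) {x} y x≤y Fx ⊆F (¬gap ∷ ¬gaps) last≡c N =
      walkʳ G v x≤v Fx (λ p∈ → ⊆F (there p∈)) ¬gaps last≡c
        (nested-extendʳ (frontiers-conserved Fx (frontierₗ cs) x≤y) (x<y cs) (¬Gap⇒≤ {y} {v} ¬gap) N)
      where
      cs : Consecutive a c y v
      cs = ∈-pairs⇒consecutive (⊆F (here refl))
      x≤v : x ≤ v
      x≤v = ≤-trans x≤y (<⇒≤ (x<y cs))

    good-gap⇒nested : ∀ {x y} → x < y → GoodGap n Ps b (x , y) → Nested n Ps b x y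
    good-gap⇒nested _ (_ , _ , (Cm , _) , N , x<m₁ , _ , m₂<y , sz) =
      step Cm (<⇒≤ x<m₁) (<⇒≤ m₂<y) (inj₁ x<m₁) N sz

    gaps⇒nested : NoGap b F ⊎ ExactlyOneGoodGap n Ps b F → Nested n Ps b a c
    gaps⇒nested (inj₁ gapFree) with head≡just⇒ {xs = F} head≡a
    ... | F′ , F≡ = walkʳ F′ a ≤-refl (start-frontier Cac) ⊆F (subst (λ X → All _ (pairs X)) F≡ gapFree)
                          (trans (cong last (sym F≡)) last≡c) (single a)
      where
      ⊆F : ∀ {p} → p ∈ pairs (a ∷ F′) → p ∈ pairs F
      ⊆F = subst (λ X → _ ∈ pairs X) (sym F≡)
    gaps⇒nested (inj₂ (L , (x , y) , R , pairs≡ , gapFreeˡ , gapFreeʳ , _ , good))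
      with pairs-suffix F L pairs≡
    ... | G , refl , last≡ =
          walkˡ F L a head≡a pairs≡ (λ p∈ → p∈) gapFreeˡ
            (walkʳ G y (<⇒≤ (x<y cs)) (frontierₗ cs) (λ p∈ → ∈-pair (∈-++⁺ʳ L (there p∈)))
                   gapFreeʳ (trans last≡ last≡c) (good-gap⇒nested (x<y cs) good))
      where
      ∈-pair : ∀ {p} → p ∈ L ++ (x , y) ∷ pairs (y ∷ G) → p ∈ pairs F
      ∈-pair = subst (_ ∈_) (sym pairs≡)
      cs : Consecutive a c x y
      cs = ∈-pairs⇒consecutive (∈-pair (∈-++⁺ʳ L (here refl)))

    nested⇔gaps : Nested n Ps b a c ⇔ (NoGap b F ⊎ ExactlyOneGoodGap n Ps b F)
    nested⇔gaps = mk⇔ (λ N → gap-condition⇒gaps (nested⇒gap-condition N Cac)) gaps⇒nested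

-- Signed permutations

_∈∣_ : ℕ → List ℤ → Set
v ∈∣ X = Any (λ x → v ≡ ∣ x ∣) X

UniqueAbs : List ℤ → Set
UniqueAbs = AllPairs (λ x y → ∣ x ∣ ≢ ∣ y ∣)

∈⇒∈∣ : ∀ {x X} → x ∈ X → ∣ x ∣ ∈∣ X
∈⇒∈∣ = Any.map (cong ∣_∣)

++-≡-++ : ∀ {A : Set} (xs ys us vs : List A) → xs ++ ys ≡ us ++ vs →
  (Σ (List A) λ m → us ≡ xs ++ m × ys ≡ m ++ vs) ⊎
  (Σ A λ w → Σ (List A) λ m → xs ≡ us ++ w ∷ m × vs ≡ w ∷ m ++ ys)
++-≡-++ [] ys us vs eq = inj₁ (us , refl , eq)
++-≡-++ (x ∷ xs) ys [] vs eq = inj₂ (x , xs , refl , sym eq)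
++-≡-++ (x ∷ xs) ys (u ∷ us) vs eq with ∷-injective eq
... | refl , eq′ with ++-≡-++ xs ys us vs eq′
...   | inj₁ (m , us≡ , ys≡) = inj₁ (m , cong (x ∷_) us≡ , ys≡)
...   | inj₂ (w , m , xs≡ , vs≡) = inj₂ (w , m , cong (x ∷_) xs≡ , vs≡)

UniqueAbs-++⁻ˡ : ∀ X {Y} → UniqueAbs (X ++ Y) → UniqueAbs X
UniqueAbs-++⁻ˡ [] _ = []
UniqueAbs-++⁻ˡ (x ∷ X) (x≢ ∷ u) = All.tabulate (λ y∈ → All.lookup x≢ (Any.++⁺ˡ y∈)) ∷ UniqueAbs-++⁻ˡ X u

UniqueAbs-++⁻ʳ : ∀ X {Y} → UniqueAbs (X ++ Y) → UniqueAbs Y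
UniqueAbs-++⁻ʳ [] u = u
UniqueAbs-++⁻ʳ (_ ∷ X) (_ ∷ u) = UniqueAbs-++⁻ʳ X u

UniqueAbs-infix : ∀ {P} L N R → UniqueAbs P → P ≡ L ++ N ++ R → UniqueAbs N
UniqueAbs-infix L N _ u refl = UniqueAbs-++⁻ˡ N (UniqueAbs-++⁻ʳ L u)

UniqueAbs-disjoint : ∀ X {Y v} → UniqueAbs (X ++ Y) → v ∈∣ X → v ∈∣ Y → ⊥
UniqueAbs-disjoint (x ∷ X) {Y} (x≢ ∷ _) (here refl) v∈Y = All¬⇒¬Any x≢ (Any.++⁺ʳ X v∈Y)
  where open import Data.List.Relation.Unary.All.Properties using (All¬⇒¬Any)
UniqueAbs-disjoint (_ ∷ X) (_ ∷ u) (there v∈X) v∈Y = UniqueAbs-disjoint X u v∈X v∈Y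

∈-iv⁻ : ∀ {a c v} → a ≤ c → v ∈ iv a c → a ≤ v × v ≤ c
∈-iv⁻ {a} {c} a≤c v∈ with ∈-map⁻ (_+_ a) v∈
... | i , i∈ , refl = m≤m+n a i , ≤-trans (+-monoʳ-≤ a (s≤s⁻¹ (∈-upTo⁻ i∈))) (≤-reflexive (m+[n∸m]≡n a≤c))

∈-iv⁺ : ∀ {a c v} → a ≤ v → v ≤ c → v ∈ iv a c
∈-iv⁺ {a} {c} a≤v v≤c =
  subst (_∈ iv a c) (m+[n∸m]≡n a≤v) (∈-map⁺ (_+_ a) (∈-upTo⁺ (s≤s (∸-monoˡ-≤ a v≤c))))

iv-unique : ∀ a c → Unique (iv a c)
iv-unique a _ = Unique.map⁺ (+-cancelˡ-≡ a _ _) (Unique.upTo⁺ _)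

Spans : ℕ → ℕ → List ℤ → Set
Spans a c B = map ∣_∣ B ↭ iv a c

spans⁻ : ∀ {a c B v} → a ≤ c → Spans a c B → v ∈∣ B → a ≤ v × v ≤ c
spans⁻ a≤c B↭ v∈ = ∈-iv⁻ a≤c (∈-resp-↭ B↭ (Any.map⁺ v∈))

spans⁺ : ∀ {a c B v} → Spans a c B → a ≤ v → v ≤ c → v ∈∣ B
spans⁺ B↭ a≤v v≤c = Any.map⁻ (∈-resp-↭ (↭-sym B↭) (∈-iv⁺ a≤v v≤c))

spans-intro : ∀ {a c B} → a ≤ c → UniqueAbs B →
  (∀ {v} → v ∈∣ B → a ≤ v × v ≤ c) → (∀ {v} → a ≤ v → v ≤ c → v ∈∣ B) → Spans a c B
spans-intro {a} {c} a≤c u bounded complete =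
  ∼bag⇒↭ (unique∧set⇒bag (AllPairs.map⁺ u) (iv-unique a c) (mk⇔
    (λ v∈ → let (a≤v , v≤c) = bounded (Any.map⁻ v∈) in ∈-iv⁺ a≤v v≤c)
    (λ v∈ → let (a≤v , v≤c) = ∈-iv⁻ a≤c v∈ in Any.map⁺ (complete a≤v v≤c))))

spans-glue : ∀ {i l A O T} → i ≤ l → UniqueAbs (A ++ T) → (∀ {v} → v ∈∣ O → v ∈∣ A) →
             (∀ {v} → v ∈∣ A ⊎ v ∈∣ (O ++ T) → i ≤ v × v ≤ l) →
             (∀ {v} → i ≤ v → v ≤ l → v ∈∣ A ⊎ v ∈∣ (O ++ T)) → Spans i l (A ++ T)
spans-glue {A = A} {O} i≤l u O⊆A bounded complete = spans-intro i≤l u bounded′ complete′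
  where
  bounded′ : ∀ {v} → v ∈∣ (A ++ _) → _
  bounded′ v∈ = [ (λ v∈A → bounded (inj₁ v∈A)) , (λ v∈T → bounded (inj₂ (Any.++⁺ʳ O v∈T))) ]′ (Any.++⁻ A v∈)
  complete′ : ∀ {v} → _ ≤ v → v ≤ _ → v ∈∣ (A ++ _)
  complete′ i≤v v≤l with complete i≤v v≤l
  ... | inj₁ v∈A = Any.++⁺ˡ v∈A
  ... | inj₂ v∈OT = [ (λ v∈O → Any.++⁺ˡ (O⊆A v∈O)) , Any.++⁺ʳ A ]′ (Any.++⁻ O v∈OT)

spans-nonempty : ∀ {a c B} → a ≤ c → Spans a c B → Σ ℤ λ w → Σ (List ℤ) λ B′ → B ≡ w ∷ B′
spans-nonempty {B = []} a≤c B↭ with spans⁺ {B = []} B↭ ≤-refl a≤c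
... | ()
spans-nonempty {B = w ∷ B′} _ _ = w , B′ , refl

Delimited : ℕ → ℕ → List ℤ → Set
Delimited a c B = (head B ≡ just (+ a) × last B ≡ just (+ c)) ⊎
                  (head B ≡ just (- (+ c)) × last B ≡ just (- (+ a)))

∣-+∣ : ∀ a → ∣ - (+ a) ∣ ≡ a
∣-+∣ a = ∣-i∣≡∣i∣ (+ a)

+≢-+ : ∀ {a m} → a < m → + a ≢ - (+ m)
+≢-+ {m = suc _} _ ()

-+≢+ : ∀ {a m} → a < m → - (+ a) ≢ + m
-+≢+ {zero} {suc _} _ ()
-+≢+ {suc _} {suc _} _ ()

++-regroupʳ : ∀ (L B : List ℤ) x Y R → L ++ ((B ++ x ∷ []) ++ Y) ++ R ≡ (L ++ B) ++ (x ∷ Y) ++ R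
++-regroupʳ [] [] _ _ _ = refl
++-regroupʳ [] (y ∷ B) x Y R = cong (y ∷_) (++-regroupʳ [] B x Y R)
++-regroupʳ (l ∷ L) B x Y R = cong (l ∷_) (++-regroupʳ L B x Y R)

++-regroupˡ : ∀ (L X : List ℤ) w B R → L ++ (X ++ ((w ∷ B) ++ [])) ++ R ≡ L ++ (X ++ w ∷ []) ++ (B ++ R)
++-regroupˡ [] [] w B R = cong (λ Z → w ∷ Z ++ R) (++-identityʳ B)
++-regroupˡ [] (x ∷ X) w B R = cong (x ∷_) (++-regroupˡ [] X w B R)
++-regroupˡ (l ∷ L) X w B R = cong (l ∷_) (++-regroupˡ L X w B R)

last-++-++-∷ : ∀ (X Z : List ℤ) y Y → last (X ++ (Z ++ y ∷ Y)) ≡ last (y ∷ Y)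
last-++-++-∷ X Z y Y = trans (cong last (sym (++-assoc X Z (y ∷ Y)))) (last-++-∷ (X ++ Z) y Y)

last-++-∷-++-[] : ∀ (X : List ℤ) w B → last (X ++ ((w ∷ B) ++ [])) ≡ last (w ∷ B)
last-++-∷-++-[] X w B = trans (last-++-∷ X w (B ++ [])) (cong (λ Z → last (w ∷ Z)) (++-identityʳ B))

sub-block : ∀ {P L₁ B₁ R₁ L₂ w B₂ R₂} → UniqueAbs P → P ≡ L₁ ++ B₁ ++ R₁ → P ≡ L₂ ++ (w ∷ B₂) ++ R₂ →
            (∀ {v} → v ∈∣ (w ∷ B₂) → v ∈∣ B₁) →
            Σ (List ℤ) λ X → Σ (List ℤ) λ Y → B₁ ≡ X ++ (w ∷ B₂) ++ Y
sub-block {P} {L₁} {B₁} {R₁} {L₂} {w} {B₂} {R₂} u P≡₁ P≡₂ ⊆B₁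
  with ++-≡-++ L₁ (B₁ ++ R₁) L₂ ((w ∷ B₂) ++ R₂) (trans (sym P≡₁) P≡₂)
... | inj₂ (w′ , m , L₁≡ , eq) =
      ⊥-elim (UniqueAbs-disjoint L₁ (subst UniqueAbs P≡₁ u)
        (subst (_ ∈∣_) (sym L₁≡) (Any.++⁺ʳ L₂ (here (cong ∣_∣ (proj₁ (∷-injective eq))))))
        (Any.++⁺ˡ (⊆B₁ (here refl))))
... | inj₁ (m , _ , eq) with ++-≡-++ B₁ R₁ m ((w ∷ B₂) ++ R₂) eq
...   | inj₁ (m′ , _ , R₁≡) =
        ⊥-elim (UniqueAbs-disjoint (L₁ ++ B₁) (subst UniqueAbs P≡ u)
                  (Any.++⁺ʳ L₁ (⊆B₁ (here refl))) (Any.++⁺ʳ m′ (here refl)))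
  where
  P≡ : P ≡ (L₁ ++ B₁) ++ m′ ++ (w ∷ B₂) ++ R₂
  P≡ = trans P≡₁ (trans (sym (++-assoc L₁ B₁ R₁)) (cong ((L₁ ++ B₁) ++_) R₁≡))
...   | inj₂ (w′ , q , B₁≡ , eq′) with ++-≡-++ (w ∷ B₂) R₂ (w′ ∷ q) R₁ eq′
...     | inj₁ (m₂ , wq≡ , _) = m , m₂ , trans B₁≡ (cong (m ++_) wq≡)
...     | inj₂ (w″ , m₃ , B₂≡ , R₁≡) =
          ⊥-elim (UniqueAbs-disjoint (L₁ ++ B₁) (subst UniqueAbs (trans P≡₁ (sym (++-assoc L₁ B₁ R₁))) u)
                    (Any.++⁺ʳ L₁ (⊆B₁ (subst (∣ w″ ∣ ∈∣_) (sym B₂≡) (Any.++⁺ʳ (w′ ∷ q) (here refl)))))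
                    (subst (∣ w″ ∣ ∈∣_) (sym R₁≡) (here refl)))

module BlockDifference {P : List ℤ} {a m c : ℕ} (u : UniqueAbs P) (a<m : a < m) (m<c : m < c) where

  a≤c : a ≤ c
  a≤c = <⇒≤ (<-trans a<m m<c)

  ∖ˡ-positive : ∀ L B Y R → P ≡ L ++ (B ++ Y) ++ R → Spans a c (B ++ Y) → last (B ++ Y) ≡ just (+ c) →
                Spans a m B → last B ≡ just (+ m) → BlockIn m c P
  ∖ˡ-positive L B Y R P≡ outer last≡c inner last≡m with last≡just⇒ {xs = B} last≡m
  ... | B′ , B≡ = L ++ B′ , + m ∷ Y , R , P≡′ ,
                  spans-intro (<⇒≤ m<c) (UniqueAbs-infix (L ++ B′) _ R u P≡′) bounded complete ,
                  inj₁ (refl , trans (sym (trans (cong (λ Z → last (Z ++ Y)) B≡)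
                                   (trans (cong last (++-assoc B′ (+ m ∷ []) Y)) (last-++-∷ B′ (+ m) Y)))) last≡c)
    where
    P≡′ : P ≡ (L ++ B′) ++ (+ m ∷ Y) ++ R
    P≡′ = trans P≡ (trans (cong (λ Z → L ++ (Z ++ Y) ++ R) B≡) (++-regroupʳ L B′ (+ m) Y R))
    bounded : ∀ {v} → v ∈∣ (+ m ∷ Y) → m ≤ v × v ≤ c
    bounded (here refl) = ≤-refl , <⇒≤ m<c
    bounded {v} (there v∈Y) with spans⁻ a≤c outer (Any.++⁺ʳ B v∈Y) | v ≤? m
    ... | a≤v , _ | yes v≤m = ⊥-elim (UniqueAbs-disjoint B (UniqueAbs-infix L _ R u P≡) (spans⁺ inner a≤v v≤m) v∈Y)
    ... | _ , v≤c | no v≰m = <⇒≤ (≰⇒> v≰m) , v≤c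
    complete : ∀ {v} → m ≤ v → v ≤ c → v ∈∣ (+ m ∷ Y)
    complete {v} m≤v v≤c with v ≟ m
    ... | yes refl = here refl
    ... | no v≢m with Any.++⁻ B (spans⁺ outer (≤-trans (<⇒≤ a<m) m≤v) v≤c)
    ...   | inj₁ v∈B = ⊥-elim (v≢m (≤-antisym (proj₂ (spans⁻ (<⇒≤ a<m) inner v∈B)) m≤v))
    ...   | inj₂ v∈Y = there v∈Y

  ∖ˡ-negative : ∀ L X B′ R → P ≡ L ++ (X ++ (- (+ m) ∷ B′) ++ []) ++ R →
                Spans a c (X ++ (- (+ m) ∷ B′) ++ []) → head (X ++ (- (+ m) ∷ B′) ++ []) ≡ just (- (+ c)) →
                Spans a m (- (+ m) ∷ B′) → BlockIn m c P
  ∖ˡ-negative L X B′ R P≡ outer head≡c inner =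
    L , X ++ - (+ m) ∷ [] , B′ ++ R , P≡′ ,
    spans-intro (<⇒≤ m<c) (UniqueAbs-infix L _ (B′ ++ R) u P≡′) bounded complete ,
    inj₂ (trans (head-++-∷ X _ [] (B′ ++ [])) head≡c , last-++-∷ʳ X _)
    where
    B : List ℤ
    B = - (+ m) ∷ B′
    P≡′ : P ≡ L ++ (X ++ - (+ m) ∷ []) ++ (B′ ++ R)
    P≡′ = trans P≡ (++-regroupˡ L X (- (+ m)) B′ R)
    bounded : ∀ {v} → v ∈∣ (X ++ - (+ m) ∷ []) → m ≤ v × v ≤ c
    bounded {v} v∈ with Any.++⁻ X v∈
    ... | inj₂ (here v≡) = let v≡m = trans v≡ (∣-+∣ m) in ≤-reflexive (sym v≡m) , ≤-trans (≤-reflexive v≡m) (<⇒≤ m<c)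
    ... | inj₁ v∈X with spans⁻ a≤c outer (Any.++⁺ˡ v∈X) | v ≤? m
    ...   | a≤v , _ | yes v≤m = ⊥-elim (UniqueAbs-disjoint X (UniqueAbs-infix L _ R u P≡) v∈X
                                           (Any.++⁺ˡ (spans⁺ inner a≤v v≤m)))
    ...   | _ , v≤c | no v≰m = <⇒≤ (≰⇒> v≰m) , v≤c
    complete : ∀ {v} → m ≤ v → v ≤ c → v ∈∣ (X ++ - (+ m) ∷ [])
    complete {v} m≤v v≤c with v ≟ m
    ... | yes refl = Any.++⁺ʳ X (here (sym (∣-+∣ v)))
    ... | no v≢m with Any.++⁻ X (spans⁺ outer (≤-trans (<⇒≤ a<m) m≤v) v≤c)
    ...   | inj₁ v∈X = Any.++⁺ˡ v∈X
    ...   | inj₂ v∈B with Any.++⁻ B v∈B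
    ...     | inj₁ v∈B′ = ⊥-elim (v≢m (≤-antisym (proj₂ (spans⁻ (<⇒≤ a<m) inner v∈B′)) m≤v))
    ...     | inj₂ ()

  ∖ʳ-positive : ∀ L X B′ R → P ≡ L ++ (X ++ (+ m ∷ B′) ++ []) ++ R →
                Spans a c (X ++ (+ m ∷ B′) ++ []) → head (X ++ (+ m ∷ B′) ++ []) ≡ just (+ a) →
                Spans m c (+ m ∷ B′) → BlockIn a m P
  ∖ʳ-positive L X B′ R P≡ outer head≡a inner =
    L , X ++ + m ∷ [] , B′ ++ R , P≡′ ,
    spans-intro (<⇒≤ a<m) (UniqueAbs-infix L _ (B′ ++ R) u P≡′) bounded complete ,
    inj₁ (trans (head-++-∷ X _ [] (B′ ++ [])) head≡a , last-++-∷ʳ X _)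
    where
    B : List ℤ
    B = + m ∷ B′
    P≡′ : P ≡ L ++ (X ++ + m ∷ []) ++ (B′ ++ R)
    P≡′ = trans P≡ (++-regroupˡ L X (+ m) B′ R)
    bounded : ∀ {v} → v ∈∣ (X ++ + m ∷ []) → a ≤ v × v ≤ m
    bounded {v} v∈ with Any.++⁻ X v∈
    ... | inj₂ (here refl) = <⇒≤ a<m , ≤-refl
    ... | inj₁ v∈X with spans⁻ a≤c outer (Any.++⁺ˡ v∈X) | m ≤? v
    ...   | _ , v≤c | yes m≤v = ⊥-elim (UniqueAbs-disjoint X (UniqueAbs-infix L _ R u P≡) v∈X
                                           (Any.++⁺ˡ (spans⁺ inner m≤v v≤c)))
    ...   | a≤v , _ | no m≰v = a≤v , <⇒≤ (≰⇒> m≰v)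
    complete : ∀ {v} → a ≤ v → v ≤ m → v ∈∣ (X ++ + m ∷ [])
    complete {v} a≤v v≤m with v ≟ m
    ... | yes refl = Any.++⁺ʳ X (here refl)
    ... | no v≢m with Any.++⁻ X (spans⁺ outer a≤v (≤-trans v≤m (<⇒≤ m<c)))
    ...   | inj₁ v∈X = Any.++⁺ˡ v∈X
    ...   | inj₂ v∈B with Any.++⁻ B v∈B
    ...     | inj₁ v∈B′ = ⊥-elim (v≢m (≤-antisym v≤m (proj₁ (spans⁻ (<⇒≤ m<c) inner v∈B′))))
    ...     | inj₂ ()

  ∖ʳ-negative : ∀ L B Y R → P ≡ L ++ (B ++ Y) ++ R → Spans a c (B ++ Y) → last (B ++ Y) ≡ just (- (+ a)) →
                Spans m c B → last B ≡ just (- (+ m)) → BlockIn a m P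
  ∖ʳ-negative L B Y R P≡ outer last≡a inner last≡m with last≡just⇒ {xs = B} last≡m
  ... | B′ , B≡ = L ++ B′ , - (+ m) ∷ Y , R , P≡′ ,
                  spans-intro (<⇒≤ a<m) (UniqueAbs-infix (L ++ B′) _ R u P≡′) bounded complete ,
                  inj₂ (refl , trans (sym (trans (cong (λ Z → last (Z ++ Y)) B≡)
                                   (trans (cong last (++-assoc B′ (- (+ m) ∷ []) Y)) (last-++-∷ B′ (- (+ m)) Y)))) last≡a)
    where
    P≡′ : P ≡ (L ++ B′) ++ (- (+ m) ∷ Y) ++ R
    P≡′ = trans P≡ (trans (cong (λ Z → L ++ (Z ++ Y) ++ R) B≡) (++-regroupʳ L B′ (- (+ m)) Y R))
    bounded : ∀ {v} → v ∈∣ (- (+ m) ∷ Y) → a ≤ v × v ≤ m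
    bounded (here v≡) = let v≡m = trans v≡ (∣-+∣ m) in ≤-trans (<⇒≤ a<m) (≤-reflexive (sym v≡m)) , ≤-reflexive v≡m
    bounded {v} (there v∈Y) with spans⁻ a≤c outer (Any.++⁺ʳ B v∈Y) | m ≤? v
    ... | _ , v≤c | yes m≤v = ⊥-elim (UniqueAbs-disjoint B (UniqueAbs-infix L _ R u P≡) (spans⁺ inner m≤v v≤c) v∈Y)
    ... | a≤v , _ | no m≰v = a≤v , <⇒≤ (≰⇒> m≰v)
    complete : ∀ {v} → a ≤ v → v ≤ m → v ∈∣ (- (+ m) ∷ Y)
    complete {v} a≤v v≤m with v ≟ m
    ... | yes refl = here (sym (∣-+∣ v))
    ... | no v≢m with Any.++⁻ B (spans⁺ outer a≤v (≤-trans v≤m (<⇒≤ m<c)))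
    ...   | inj₁ v∈B = ⊥-elim (v≢m (≤-antisym v≤m (proj₁ (spans⁻ (<⇒≤ m<c) inner v∈B))))
    ...   | inj₂ v∈Y = there v∈Y

  -- The inner block contains the shared endpoint, which fixes where it sits in the outer
  -- block and forces both blocks to have the same orientation.
  ∖ˡ-inside : ∀ L X w B Y R → P ≡ L ++ (X ++ (w ∷ B) ++ Y) ++ R →
              Spans a c (X ++ (w ∷ B) ++ Y) → Delimited a c (X ++ (w ∷ B) ++ Y) →
              Spans a m (w ∷ B) → Delimited a m (w ∷ B) → BlockIn m c P
  ∖ˡ-inside L (x ∷ X) w B Y R P≡ _ (inj₁ (head≡a , _)) inner _ =
    ⊥-elim (UniqueAbs-disjoint (x ∷ X) (UniqueAbs-infix L _ R u P≡)
              (here (sym (cong ∣_∣ (Maybe.just-injective head≡a)))) (Any.++⁺ˡ (spans⁺ inner ≤-refl (<⇒≤ a<m))))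
  ∖ˡ-inside L [] w B Y R _ _ (inj₁ (head≡a , _)) _ (inj₂ (head≡m , _)) =
    ⊥-elim (+≢-+ a<m (trans (sym (Maybe.just-injective head≡a)) (Maybe.just-injective head≡m)))
  ∖ˡ-inside L [] w B Y R P≡ outer (inj₁ (_ , last≡c)) inner (inj₁ (_ , last≡m)) =
    ∖ˡ-positive L (w ∷ B) Y R P≡ outer last≡c inner last≡m
  ∖ˡ-inside L X w B (y ∷ Y) R P≡ _ (inj₂ (_ , last≡a)) inner _ =
    ⊥-elim (UniqueAbs-disjoint (w ∷ B) (UniqueAbs-++⁻ʳ X (UniqueAbs-infix L _ R u P≡))
              (spans⁺ inner ≤-refl (<⇒≤ a<m))
              (subst (_∈∣ (y ∷ Y)) (∣-+∣ a) (∈⇒∈∣ (last∈ (trans (sym (last-++-++-∷ X (w ∷ B) y Y)) last≡a)))))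
  ∖ˡ-inside L X w B [] R _ _ (inj₂ (_ , last≡a)) _ (inj₁ (_ , last≡m)) =
    ⊥-elim (-+≢+ a<m (Maybe.just-injective (trans (sym last≡a) (trans (last-++-∷-++-[] X w B) last≡m))))
  ∖ˡ-inside L X w B [] R P≡ outer (inj₂ (head≡c , _)) inner (inj₂ (head≡m , _))
    with Maybe.just-injective head≡m
  ... | refl = ∖ˡ-negative L X B R P≡ outer head≡c inner

  ∖ʳ-inside : ∀ L X w B Y R → P ≡ L ++ (X ++ (w ∷ B) ++ Y) ++ R →
              Spans a c (X ++ (w ∷ B) ++ Y) → Delimited a c (X ++ (w ∷ B) ++ Y) →
              Spans m c (w ∷ B) → Delimited m c (w ∷ B) → BlockIn a m P
  ∖ʳ-inside L X w B (y ∷ Y) R P≡ _ (inj₁ (_ , last≡c)) inner _ =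
    ⊥-elim (UniqueAbs-disjoint (w ∷ B) (UniqueAbs-++⁻ʳ X (UniqueAbs-infix L _ R u P≡))
              (spans⁺ inner (<⇒≤ m<c) ≤-refl)
              (∈⇒∈∣ (last∈ (trans (sym (last-++-++-∷ X (w ∷ B) y Y)) last≡c))))
  ∖ʳ-inside L X w B [] R _ _ (inj₁ (_ , last≡c)) _ (inj₂ (_ , last≡m)) =
    ⊥-elim (-+≢+ m<c (Maybe.just-injective (trans (sym last≡m) (trans (sym (last-++-∷-++-[] X w B)) last≡c))))
  ∖ʳ-inside L X w B [] R P≡ outer (inj₁ (head≡a , _)) inner (inj₁ (head≡m , _))
    with Maybe.just-injective head≡m
  ... | refl = ∖ʳ-positive L X B R P≡ outer head≡a inner
  ∖ʳ-inside L (x ∷ X) w B Y R P≡ _ (inj₂ (head≡c , _)) inner _ =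
    ⊥-elim (UniqueAbs-disjoint (x ∷ X) (UniqueAbs-infix L _ R u P≡)
              (here (trans (sym (∣-+∣ c)) (sym (cong ∣_∣ (Maybe.just-injective head≡c)))))
              (Any.++⁺ˡ (spans⁺ inner (<⇒≤ m<c) ≤-refl)))
  ∖ʳ-inside L [] w B Y R _ _ (inj₂ (head≡c , _)) _ (inj₁ (head≡m , _)) =
    ⊥-elim (+≢-+ m<c (trans (sym (Maybe.just-injective head≡m)) (Maybe.just-injective head≡c)))
  ∖ʳ-inside L [] w B Y R P≡ outer (inj₂ (_ , last≡a)) inner (inj₂ (_ , last≡m)) =
    ∖ʳ-negative L (w ∷ B) Y R P≡ outer last≡a inner last≡m

  block-∖ˡ : BlockIn a c P → BlockIn a m P → BlockIn m c P
  block-∖ˡ (L₁ , B₁ , R₁ , P≡₁ , outer , d₁) (L₂ , _ , _ , P≡₂ , inner , d₂)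
    with spans-nonempty (<⇒≤ a<m) inner
  ... | w , B , refl with sub-block {L₁ = L₁} {B₁} {R₁} {L₂} u P≡₁ P≡₂ ⊆outer
    where
    ⊆outer : ∀ {v} → v ∈∣ (w ∷ B) → v ∈∣ B₁
    ⊆outer v∈ with spans⁻ (<⇒≤ a<m) inner v∈
    ... | a≤v , v≤m = spans⁺ outer a≤v (≤-trans v≤m (<⇒≤ m<c))
  ... | X , Y , refl = ∖ˡ-inside L₁ X w B Y R₁ P≡₁ outer d₁ inner d₂

  block-∖ʳ : BlockIn a c P → BlockIn m c P → BlockIn a m P
  block-∖ʳ (L₁ , B₁ , R₁ , P≡₁ , outer , d₁) (L₂ , _ , _ , P≡₂ , inner , d₂)
    with spans-nonempty (<⇒≤ m<c) inner
  ... | w , B , refl with sub-block {L₁ = L₁} {B₁} {R₁} {L₂} u P≡₁ P≡₂ ⊆outer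
    where
    ⊆outer : ∀ {v} → v ∈∣ (w ∷ B) → v ∈∣ B₁
    ⊆outer v∈ with spans⁻ (<⇒≤ m<c) inner v∈
    ... | m≤v , v≤c = spans⁺ outer (≤-trans (<⇒≤ a<m) m≤v) v≤c
  ... | X , Y , refl = ∖ʳ-inside L₁ X w B Y R₁ P≡₁ outer d₁ inner d₂

-- Blocks (i..j) and (k..l) with i < k ≤ j < l share the values k..j, so their positions
-- overlap too. Their union is a block once the orientations agree, and they must agree,
-- since otherwise i would lie in the second block or l in the first.
module BlockUnion {P : List ℤ} {i k j l : ℕ} (u : UniqueAbs P) (i<k : i < k) (k≤j : k ≤ j) (j<l : j < l)
                  {L₁ B₁ R₁ L₂ B₂ R₂ : List ℤ}
                  (P≡₁ : P ≡ L₁ ++ B₁ ++ R₁) (span₁ : Spans i j B₁) (delim₁ : Delimited i j B₁)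
                  (P≡₂ : P ≡ L₂ ++ B₂ ++ R₂) (span₂ : Spans k l B₂) (delim₂ : Delimited k l B₂) where

  i≤j : i ≤ j
  i≤j = <⇒≤ (<-≤-trans i<k k≤j)
  k≤l : k ≤ l
  k≤l = <⇒≤ (≤-<-trans k≤j j<l)
  i≤l : i ≤ l
  i≤l = <⇒≤ (<-trans (<-≤-trans i<k k≤j) j<l)

  k∈B₁ : k ∈∣ B₁
  k∈B₁ = spans⁺ span₁ (<⇒≤ i<k) k≤j

  k∈B₂ : k ∈∣ B₂
  k∈B₂ = spans⁺ span₂ ≤-refl k≤l

  l∉B₁ : ¬ l ∈∣ B₁
  l∉B₁ l∈ = <⇒≱ j<l (proj₂ (spans⁻ i≤j span₁ l∈))

  i∉B₂ : ¬ i ∈∣ B₂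
  i∉B₂ i∈ = <⇒≱ i<k (proj₁ (spans⁻ k≤l span₂ i∈))

  in-range : ∀ {v} → v ∈∣ B₁ ⊎ v ∈∣ B₂ → i ≤ v × v ≤ l
  in-range (inj₁ v∈) with spans⁻ i≤j span₁ v∈
  ... | i≤v , v≤j = i≤v , ≤-trans v≤j (<⇒≤ j<l)
  in-range (inj₂ v∈) with spans⁻ k≤l span₂ v∈
  ... | k≤v , v≤l = ≤-trans (<⇒≤ i<k) k≤v , v≤l

  in-either : ∀ {v} → i ≤ v → v ≤ l → v ∈∣ B₁ ⊎ v ∈∣ B₂
  in-either {v} i≤v v≤l with v ≤? j
  ... | yes v≤j = inj₁ (spans⁺ span₁ i≤v v≤j)
  ... | no v≰j = inj₂ (spans⁺ span₂ (≤-trans k≤j (<⇒≤ (≰⇒> v≰j))) v≤l)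

  B₁-first : ∀ m → B₁ ++ R₁ ≡ m ++ (B₂ ++ R₂) → BlockIn i l P
  B₁-first m eq with ++-≡-++ B₁ R₁ m (B₂ ++ R₂) eq
  ... | inj₁ (m′ , _ , R₁≡) =
        ⊥-elim (UniqueAbs-disjoint (L₁ ++ B₁) (subst UniqueAbs (trans P≡₁ (sym (++-assoc L₁ B₁ R₁))) u)
                  (Any.++⁺ʳ L₁ k∈B₁) (subst (_ ∈∣_) (sym R₁≡) (Any.++⁺ʳ m′ (Any.++⁺ˡ k∈B₂))))
  ... | inj₂ (w , q , B₁≡ , eq′) with ++-≡-++ B₂ R₂ (w ∷ q) R₁ eq′
  ...   | inj₁ (m₂ , wq≡ , _) =
          ⊥-elim (l∉B₁ (subst (_ ∈∣_) (sym B₁≡) (Any.++⁺ʳ m (subst (_ ∈∣_) (sym wq≡)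
                   (Any.++⁺ˡ (spans⁺ span₂ k≤l ≤-refl))))))
  ...   | inj₂ (w′ , t , B₂≡ , R₁≡) = glue delim₁ delim₂
    where
    T : List ℤ
    T = w′ ∷ t
    O⊆B₁ : ∀ {v} → v ∈∣ (w ∷ q) → v ∈∣ B₁
    O⊆B₁ v∈ = subst (_ ∈∣_) (sym B₁≡) (Any.++⁺ʳ m v∈)
    glue : Delimited i j B₁ → Delimited k l B₂ → BlockIn i l P
    glue _ (inj₂ (head≡ , _)) = ⊥-elim (l∉B₁ (O⊆B₁ (here (sym (trans
      (cong ∣_∣ (Maybe.just-injective (trans (cong head (sym B₂≡)) head≡))) (∣-+∣ l))))))
    glue (inj₂ (_ , last≡)) (inj₁ _) = ⊥-elim (i∉B₂ (subst (_ ∈∣_) (sym B₂≡) (Any.++⁺ˡ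
      (subst (_∈∣ (w ∷ q)) (∣-+∣ i)
        (∈⇒∈∣ (last∈ (trans (sym (last-++-∷ m w q)) (trans (cong last (sym B₁≡)) last≡))))))))
    glue (inj₁ (head≡ , _)) (inj₁ (_ , last≡)) =
      L₁ , B₁ ++ T , R₂ , P≡′ ,
      spans-glue i≤l (UniqueAbs-infix L₁ _ R₂ u P≡′) O⊆B₁
        (λ v∈ → in-range (Data.Sum.map₂ (subst (_ ∈∣_) (sym B₂≡)) v∈))
        (λ i≤v v≤l → Data.Sum.map₂ (subst (_ ∈∣_) B₂≡) (in-either i≤v v≤l)) ,
      inj₁ (head-++ T head≡ ,
            trans (last-++-∷ B₁ w′ t) (trans (sym (last-++-∷ (w ∷ q) w′ t)) (trans (cong last (sym B₂≡)) last≡)))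
      where
      P≡′ : P ≡ L₁ ++ (B₁ ++ T) ++ R₂
      P≡′ = trans P≡₁ (trans (cong (λ Z → L₁ ++ B₁ ++ Z) R₁≡) (cong (L₁ ++_) (sym (++-assoc B₁ T R₂))))

  B₂-first : ∀ w m → L₁ ≡ L₂ ++ w ∷ m → B₂ ++ R₂ ≡ w ∷ m ++ (B₁ ++ R₁) → BlockIn i l P
  B₂-first w m L₁≡ eq with ++-≡-++ B₂ R₂ (w ∷ m) (B₁ ++ R₁) eq
  ... | inj₁ (m′ , wm≡ , _) =
        ⊥-elim (UniqueAbs-disjoint L₁ (subst UniqueAbs P≡₁ u)
                  (subst (_ ∈∣_) (sym L₁≡) (Any.++⁺ʳ L₂ (subst (_ ∈∣_) (sym wm≡) (Any.++⁺ˡ k∈B₂))))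
                  (Any.++⁺ˡ k∈B₁))
  ... | inj₂ (w′ , q , B₂≡ , eq′) with ++-≡-++ B₁ R₁ (w′ ∷ q) R₂ eq′
  ...   | inj₁ (q′ , wq≡ , _) =
          ⊥-elim (i∉B₂ (subst (_ ∈∣_) (sym B₂≡) (Any.++⁺ʳ (w ∷ m) (subst (_ ∈∣_) (sym wq≡)
                   (Any.++⁺ˡ (spans⁺ span₁ ≤-refl i≤j))))))
  ...   | inj₂ (w″ , t , B₁≡ , R₂≡) = glue delim₁ delim₂
    where
    T : List ℤ
    T = w″ ∷ t
    O⊆B₂ : ∀ {v} → v ∈∣ (w′ ∷ q) → v ∈∣ B₂
    O⊆B₂ v∈ = subst (_ ∈∣_) (sym B₂≡) (Any.++⁺ʳ (w ∷ m) v∈)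
    glue : Delimited i j B₁ → Delimited k l B₂ → BlockIn i l P
    glue (inj₁ (head≡ , _)) _ = ⊥-elim (i∉B₂ (O⊆B₂ (here (sym
      (cong ∣_∣ (Maybe.just-injective (trans (cong head (sym B₁≡)) head≡)))))))
    glue (inj₂ _) (inj₁ (_ , last≡)) = ⊥-elim (l∉B₁ (subst (_ ∈∣_) (sym B₁≡) (Any.++⁺ˡ
      (∈⇒∈∣ (last∈ {xs = w′ ∷ q}
        (trans (sym (last-++-∷ (w ∷ m) w′ q)) (trans (cong last (sym B₂≡)) last≡)))))))
    glue (inj₂ (_ , last≡)) (inj₂ (head≡ , _)) =
      L₂ , B₂ ++ T , R₁ , P≡′ ,
      spans-glue i≤l (UniqueAbs-infix L₂ _ R₁ u P≡′) O⊆B₂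
        (λ v∈ → in-range (Data.Sum.swap (Data.Sum.map₂ (subst (_ ∈∣_) (sym B₁≡)) v∈)))
        (λ i≤v v≤l → Data.Sum.swap (Data.Sum.map₁ (subst (_ ∈∣_) B₁≡) (in-either i≤v v≤l))) ,
      inj₂ (head-++ T head≡ ,
            trans (last-++-∷ B₂ w″ t) (trans (sym (last-++-∷ (w′ ∷ q) w″ t)) (trans (cong last (sym B₁≡)) last≡)))
      where
      P≡′ : P ≡ L₂ ++ (B₂ ++ T) ++ R₁
      P≡′ = trans P≡₂ (trans (cong (λ Z → L₂ ++ B₂ ++ Z) R₂≡) (cong (L₂ ++_) (sym (++-assoc B₂ T R₁))))

  union : BlockIn i l P
  union with ++-≡-++ L₁ (B₁ ++ R₁) L₂ (B₂ ++ R₂) (trans (sym P≡₁) P≡₂)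
  ... | inj₁ (m , _ , eq) = B₁-first m eq
  ... | inj₂ (w , m , L₁≡ , eq) = B₂-first w m L₁≡ eq

block-∪ : ∀ {P i k j l} → UniqueAbs P → i < k → k ≤ j → j < l → BlockIn i j P → BlockIn k l P → BlockIn i l P
block-∪ u i<k k≤j j<l (L₁ , B₁ , R₁ , P≡₁ , span₁ , delim₁) (L₂ , B₂ , R₂ , P≡₂ , span₂ , delim₂) =
  BlockUnion.union u i<k k≤j j<l {L₁} {B₁} {R₁} {L₂} {B₂} {R₂} P≡₁ span₁ delim₁ P≡₂ span₂ delim₂

map∣+∣ : ∀ (xs : List ℕ) → map ∣_∣ (map +_ xs) ≡ xs
map∣+∣ [] = refl
map∣+∣ (x ∷ xs) = cong (x ∷_) (map∣+∣ xs)

idPerm-signed : ∀ n → IsSignedPerm n (idPerm n)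
idPerm-signed n = ↭-reflexive (map∣+∣ (iv 1 n))

signed⇒UniqueAbs : ∀ {n P} → IsSignedPerm n P → UniqueAbs P
signed⇒UniqueAbs {n} P↭ =
  AllPairs.map⁻ (↭ₛ.Unique-resp-↭ (setoid ℕ) (↭⇒↭ₛ (↭-sym P↭)) (iv-unique 1 n))

block-bounds : ∀ {n P a c v} → 1 ≤ n → IsSignedPerm n P → BlockIn a c P → a ≤ v → v ≤ c → 1 ≤ v × v ≤ n
block-bounds 1≤n P↭ (L , B , R , refl , span , _) a≤v v≤c =
  ∈-iv⁻ 1≤n (∈-resp-↭ P↭ (Any.map⁺ (Any.++⁺ʳ L (Any.++⁺ˡ (spans⁺ span a≤v v≤c)))))

++-split? : ∀ (P : List ℤ) (Q : List ℤ → List ℤ → Set) → (∀ B R → P ≡ B ++ R → Dec (Q B R)) →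
            Dec (Σ (List ℤ) λ B → Σ (List ℤ) λ R → P ≡ B ++ R × Q B R)
++-split? [] Q Q? with Q? [] [] refl
... | yes q = yes ([] , [] , refl , q)
... | no ¬q = no λ { ([] , [] , refl , q) → ¬q q }
++-split? (x ∷ P) Q Q?
  with Q? [] (x ∷ P) refl | ++-split? P (λ B R → Q (x ∷ B) R) (λ B R P≡ → Q? (x ∷ B) R (cong (x ∷_) P≡))
... | yes q | _ = yes ([] , x ∷ P , refl , q)
... | no _ | yes (B , R , P≡ , q) = yes (x ∷ B , R , cong (x ∷_) P≡ , q)
... | no ¬q | no ¬q′ = no λ { ([] , _ , refl , q) → ¬q q ; (_ ∷ B , R , refl , q) → ¬q′ (B , R , refl , q) }

spans? : ∀ {a c B} → a ≤ c → UniqueAbs B → Dec (Spans a c B)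
spans? {a} {c} {B} a≤c u
  with All.all? (λ x → (a ≤? ∣ x ∣) ×-dec (∣ x ∣ ≤? c)) B
     | All.all? (λ v → Any.any? (λ x → v ≟ ∣ x ∣) B) (iv a c)
... | yes bounded | yes complete =
      yes (spans-intro a≤c u bounded′ λ a≤v v≤c → All.lookup complete (∈-iv⁺ a≤v v≤c))
  where
  bounded′ : ∀ {v} → v ∈∣ B → a ≤ v × v ≤ c
  bounded′ v∈ with All.lookupAny bounded v∈
  ... | bounds , v≡ = subst (λ w → a ≤ w × w ≤ c) (sym v≡) bounds
... | no ¬bounded | _ = no λ span → ¬bounded (All.tabulate λ x∈ → spans⁻ a≤c span (∈⇒∈∣ x∈))
... | _ | no ¬complete = no λ span → ¬complete (All.tabulate λ v∈ →
        let (a≤v , v≤c) = ∈-iv⁻ a≤c v∈ in spans⁺ span a≤v v≤c)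

delimited? : ∀ a c B → Dec (Delimited a c B)
delimited? a c B = (head B ≟ᴹ just (+ a) ×-dec last B ≟ᴹ just (+ c)) ⊎-dec
                   (head B ≟ᴹ just (- (+ c)) ×-dec last B ≟ᴹ just (- (+ a)))
  where
  _≟ᴹ_ : (x y : Maybe ℤ) → Dec (x ≡ y)
  _≟ᴹ_ = Maybe.≡-dec _≟ℤ_

block? : ∀ {a c P} → a ≤ c → UniqueAbs P → Dec (BlockIn a c P)
block? {a} {c} {P} a≤c u = map′
  (λ (L , M , P≡ , B , R , M≡ , block) → L , B , R , trans P≡ (cong (L ++_) M≡) , block)
  (λ (L , B , R , P≡ , block) → L , B ++ R , P≡ , B , R , refl , block)
  (++-split? P _ λ L M P≡ → ++-split? M _ λ B R M≡ →
    spans? a≤c (UniqueAbs-infix L B R u (trans P≡ (cong (L ++_) M≡))) ×-dec delimited? a c B)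
  where open import Relation.Nullary.Decidable using (map′)

module SignedPermutations (n : ℕ) (1≤n : 1 ≤ n) (rest : List (List ℤ)) (signed : All (IsSignedPerm n) rest) where

  Ps : Family
  Ps = idPerm n ∷ rest

  unique : All UniqueAbs Ps
  unique = signed⇒UniqueAbs {n} (idPerm-signed n) ∷ All.map (signed⇒UniqueAbs {n}) signed

  blocks : ∀ {a c} → a < c → Conserved n Ps a c → All (BlockIn a c) Ps
  blocks a<c (inj₁ (refl , _)) = ⊥-elim (<-irrefl refl a<c)
  blocks _ (inj₂ (_ , bs)) = bs

  conserved-bounds : ∀ {a c} → Conserved n Ps a c → a ≤ c × 1 ≤ a × c ≤ n
  conserved-bounds (inj₁ (refl , 1≤a , a≤n)) = ≤-refl , 1≤a , a≤n
  conserved-bounds (inj₂ (a<c , block ∷ _)) =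
    <⇒≤ a<c , proj₁ (block-bounds 1≤n (idPerm-signed n) block ≤-refl (<⇒≤ a<c)) ,
              proj₂ (block-bounds 1≤n (idPerm-signed n) block (<⇒≤ a<c) ≤-refl)

  conserved-∪ : ∀ {i k j l} → i < k → k ≤ j → j < l → Conserved n Ps i j → Conserved n Ps k l → Conserved n Ps i l
  conserved-∪ {i} {k} {j} i<k k≤j j<l Cij Ckl = inj₂ (<-trans i<j j<l ,
    All.zipWith (λ ((u , β₁) , β₂) → block-∪ u i<k k≤j j<l β₁ β₂)
                (All.zip (unique , blocks i<j Cij) , blocks (≤-<-trans k≤j j<l) Ckl))
    where
    i<j : i < j
    i<j = <-≤-trans i<k k≤j

  conserved-∖ˡ : ∀ {a m c} → a < m → m < c → Conserved n Ps a c → Conserved n Ps a m → Conserved n Ps m c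
  conserved-∖ˡ a<m m<c Cac Cam = inj₂ (m<c ,
    All.zipWith (λ ((u , β₁) , β₂) → BlockDifference.block-∖ˡ u a<m m<c β₁ β₂)
                (All.zip (unique , blocks (<-trans a<m m<c) Cac) , blocks a<m Cam))

  conserved-∖ʳ : ∀ {a m c} → a < m → m < c → Conserved n Ps a c → Conserved n Ps m c → Conserved n Ps a m
  conserved-∖ʳ a<m m<c Cac Cmc = inj₂ (a<m ,
    All.zipWith (λ ((u , β₁) , β₂) → BlockDifference.block-∖ʳ u a<m m<c β₁ β₂)
                (All.zip (unique , blocks (<-trans a<m m<c) Cac) , blocks m<c Cmc))

  conserved? : ∀ a c → Dec (Conserved n Ps a c)
  conserved? a c = ((a ≟ c) ×-dec ((1 ≤? a) ×-dec (a ≤? n))) ⊎-dec blocks?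
    where
    open import Relation.Nullary.Decidable using (map′)
    all-blocks? : a < c → ∀ {Qs} → All UniqueAbs Qs → Dec (All (BlockIn a c) Qs)
    all-blocks? _ [] = yes []
    all-blocks? a<c (u ∷ us) = map′ (λ (β , βs) → β ∷ βs) (λ { (β ∷ βs) → β , βs })
                                    (block? (<⇒≤ a<c) u ×-dec all-blocks? a<c us)
    blocks? : Dec (a < c × All (BlockIn a c) Ps)
    blocks? with a <? c
    ... | no a≮c = no λ (a<c , _) → a≮c a<c
    ... | yes a<c with all-blocks? a<c unique
    ...   | yes bs = yes (a<c , bs)
    ...   | no ¬bs = no λ (_ , bs) → ¬bs bs

theorem7 : (n : ℕ) → 2 ≤ n →
    (rest : List (List ℤ)) →
    All (λ P → IsSignedPerm n P × StartsEnds n P) rest →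
    (b : ℕ) → 1 ≤ b →
    (a c : ℕ) → Conserved n (idPerm n ∷ rest) a c →
    (F : List ℕ) → IsMaxFrontiers n (idPerm n ∷ rest) a c F →
    Nested n (idPerm n ∷ rest) b a c ⇔
      (NoGap b F ⊎ ExactlyOneGoodGap n (idPerm n ∷ rest) b F)
theorem7 n 2≤n rest perms b _ a c Cac F maxF = MaxFrontiers.nested⇔gaps Cac F maxF
  where
  open SignedPermutations n (≤-trans (s≤s z≤n) 2≤n) rest (All.map proj₁ perms)
  open IntervalCalculus n Ps b conserved-bounds conserved-∪ conserved-∖ˡ conserved-∖ʳ conserved?
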